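{- Let $\mathbf M_1=\sum_{i\ge1}a_i\in K\langle A\rangle^+$. The sub-dendriform trialgebra of $(K\langle A\rangle^+,\triangleleft,\circ,\triangleright)$ generated by $\mathbf M_1$ is free as a dendriform trialgebra (on the generator $\mathbf M_1$); that is, the morphism of dendriform trialgebras from the free dendriform trialgebra on one generator $x$ to $K\langle A\rangle^+$ sending $x$ to $\mathbf M_1$ is injective.
   Context: $K$ is a field of characteristic $0$; $A=\{a_1<a_2<\cdots\}$ is an infinite totally ordered alphabet, $K\langle A\rangle$ is the projective limit of the free associative algebras $K\langle a_1,\dots,a_n\rangle$ (infinite sums of words of bounded length allowed), and $K\langle A\rangle^+$ its augmentation ideal. $\max(w)$ is the greatest letter of a word $w$. For nonempty words $u,v$: $u\triangleleft v=uv$ if $\max(u)>\max(v)$, else $0$; $u\circ v=uv$ if $\max(u)=\max(v)$, else $0$; $u\triangleright v=uv$ if $\max(u)<\max(v)$, else $0$; extended bilinearly (termwise on infinite sums). A dendriform trialgebra is a vector space with bilinear operations $\triangleleft,\circ,\triangleright$ such that, with $x\odot y=x\triangleleft y+x\circ y+x\triangleright y$: $\circ$ is associative and $(x\triangleleft y)\triangleleft z=x\triangleleft(y\odot z)$, $(x\triangleright y)\triangleleft z=x\triangleright(y\triangleleft z)$, $(x\odot y)\triangleright z=x\triangleright(y\triangleright z)$, $(x\triangleright y)\circ z=x\triangleright(y\circ z)$, $(x\triangleleft y)\circ z=x\circ(y\triangleright z)$, $(x\circ y)\triangleleft z=x\circ(y\triangleleft z)$. ($K\langle A\rangle^+$ with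 these operations is a dendriform trialgebra.) -}

module Defs where

open import Level using (Level; _⊔_)
open import Algebra.Bundles using (CommutativeRing)
open import Data.Nat as ℕ using (ℕ; zero; suc; _⊔_)
open import Data.Nat.Properties using (<-cmp)
open import Data.List using (List; []; _∷_; map; concatMap; _++_; foldr)
open import Data.Product using (_×_; _,_; Σ; ∃)
open import Relation.Binary.Definitions using (tri<; tri≈; tri>)
open import Relation.Binary.PropositionalEquality using (_≡_; refl; cong; cong₂)
open import Relation.Nullary using (¬_; Dec; yes; no)
open import Relation.Nullary.Decidable using (map′)

record Field (c ℓ : Level) : Set (Level.suc (c Level.⊔ ℓ)) where
  field
    commRing : CommutativeRing c ℓ
  open CommutativeRing commRing public
  field
    1≉0     : ¬ (1# ≈ 0#)
    inverse : ∀ x → ¬ (x ≈ 0#) → Σ Carrier (λ y → x * y ≈ 1#)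

module _ {c ℓ : Level} (K : Field c ℓ) where
  open Field K

  natK : ℕ → Carrier
  natK zero    = 0#
  natK (suc n) = 1# + natK n

  CharZero : Set ℓ
  CharZero = ∀ n → ¬ (natK (suc n) ≈ 0#)

-- Words over A = {a_0 < a_1 < ...} (letters encoded by ℕ, order of ℕ)

Word : Set
Word = List ℕ

maxW : ℕ → List ℕ → ℕ
maxW a []       = a
maxW a (b ∷ bs) = a ℕ.⊔ maxW b bs

data Op : Set where
  ◁ ∘ ▷ : Op

-- splittings of a word w = u v with u = (a ∷ as) and v = (b ∷ bs) both nonempty;
-- returned as pairs of the nonempty words in "head/tail" form
splits : ℕ → List ℕ → List ((ℕ × List ℕ) × (ℕ × List ℕ))
splits a []       = []
splits a (b ∷ bs) = ((a , []) , (b , bs)) ∷ map (λ { ((x , xs) , v) → ((a , x ∷ xs) , v) }) (splits b bs)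

-- K⟨A⟩ (coefficient functions on words; degree-bounded series are a
-- subspace of this) and the three products on K⟨A⟩⁺

module Series {c ℓ : Level} (K : Field c ℓ) where
  open Field K

  Ser : Set c
  Ser = Word → Carrier

  M₁ : Ser
  M₁ []          = 0#
  M₁ (_ ∷ [])    = 1#
  M₁ (_ ∷ _ ∷ _) = 0#

  sel : Op → ℕ → ℕ → Carrier → Carrier
  sel ◁ m n x with <-cmp m n
  ... | tri> _ _ _ = x
  ... | tri≈ _ _ _ = 0#
  ... | tri< _ _ _ = 0#
  sel ∘ m n x with <-cmp m n
  ... | tri> _ _ _ = 0#
  ... | tri≈ _ _ _ = x
  ... | tri< _ _ _ = 0#
  sel ▷ m n x with <-cmp m n
  ... | tri> _ _ _ = 0#
  ... | tri≈ _ _ _ = 0#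
  ... | tri< _ _ _ = x

  sumK : List Carrier → Carrier
  sumK = foldr _+_ 0#

  -- (f op g)(w) = Σ_{w = uv, u,v ≠ ε, condition on max u, max v} f(u) g(v)
  -- (only the parts of f, g in K⟨A⟩⁺, i.e. on nonempty words, contribute)
  prod : Op → Ser → Ser → Ser
  prod op f g []       = 0#
  prod op f g (a ∷ as) =
    sumK (map (λ { ((x , xs) , (y , ys)) →
                     sel op (maxW x xs) (maxW y ys) (f (x ∷ xs) * g (y ∷ ys)) })
              (splits a as))

-- Free magma with three operations on one generator x (monomials of the
-- free dendriform trialgebra before imposing the relations)

data Tree : Set where
  x    : Tree
  node : Op → Tree → Tree → Tree

_≟Op_ : (o p : Op) → Dec (o ≡ p)
◁ ≟Op ◁ = yes refl
◁ ≟Op ∘ = no (λ ())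
◁ ≟Op ▷ = no (λ ())
∘ ≟Op ◁ = no (λ ())
∘ ≟Op ∘ = yes refl
∘ ≟Op ▷ = no (λ ())
▷ ≟Op ◁ = no (λ ())
▷ ≟Op ∘ = no (λ ())
▷ ≟Op ▷ = yes refl

_≟T_ : (s t : Tree) → Dec (s ≡ t)
x ≟T x = yes refl
x ≟T node _ _ _ = no (λ ())
node _ _ _ ≟T x = no (λ ())
node o s₁ s₂ ≟T node p t₁ t₂ with o ≟Op p | s₁ ≟T t₁ | s₂ ≟T t₂
... | yes refl | yes refl | yes refl = yes refl
... | no ne | _ | _ = no (λ { refl → ne refl })
... | yes _ | no ne | _ = no (λ { refl → ne refl })
... | yes _ | yes _ | no ne = no (λ { refl → ne refl })

data Ctx : Set where
  hole : Ctx
  inL  : Op → Ctx → Tree → Ctx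
  inR  : Op → Tree → Ctx → Ctx

plug : Ctx → Tree → Tree
plug hole         t = t
plug (inL o C r)  t = node o (plug C t) r
plug (inR o l C)  t = node o l (plug C t)

data Rel : Set where
  assoc∘ r◁◁ r▷◁ r⊙▷ r▷∘ r◁∘ r∘◁ : Rel

module FreeTri {c ℓ : Level} (K : Field c ℓ) where
  open Field K
  open Series K

  -- finite K-linear combinations of monomials = free K-module on Tree
  LC : Set c
  LC = List (Carrier × Tree)

  coeff : LC → Tree → Carrier
  coeff []            t = 0#
  coeff ((a , s) ∷ p) t with s ≟T t
  ... | yes _ = a + coeff p t
  ... | no  _ = coeff p t

  ⊙ : Tree → Tree → LC
  ⊙ s t = (1# , node ◁ s t) ∷ (1# , node ∘ s t) ∷ (1# , node ▷ s t) ∷ []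

  neg : LC → LC
  neg = map (λ { (a , s) → (- a , s) })

  lOp : Op → LC → Tree → LC
  lOp o p r = map (λ { (a , s) → (a , node o s r) }) p

  rOp : Op → Tree → LC → LC
  rOp o l p = map (λ { (a , s) → (a , node o l s) }) p

  relator : Rel → Tree → Tree → Tree → LC
  relator assoc∘ s t u = (1# , node ∘ (node ∘ s t) u) ∷ (- 1# , node ∘ s (node ∘ t u)) ∷ []
  relator r◁◁ s t u = (1# , node ◁ (node ◁ s t) u) ∷ neg (rOp ◁ s (⊙ t u))
  relator r▷◁ s t u = (1# , node ◁ (node ▷ s t) u) ∷ (- 1# , node ▷ s (node ◁ t u)) ∷ []
  relator r⊙▷ s t u = lOp ▷ (⊙ s t) u ++ ((- 1# , node ▷ s (node ▷ t u)) ∷ [])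
  relator r▷∘ s t u = (1# , node ∘ (node ▷ s t) u) ∷ (- 1# , node ▷ s (node ∘ t u)) ∷ []
  relator r◁∘ s t u = (1# , node ∘ (node ◁ s t) u) ∷ (- 1# , node ∘ s (node ▷ t u)) ∷ []
  relator r∘◁ s t u = (1# , node ◁ (node ∘ s t) u) ∷ (- 1# , node ∘ s (node ◁ t u)) ∷ []

  -- generators of the two-sided ideal of relations: c · C[relator]
  Gen : Set c
  Gen = Carrier × Ctx × Rel × Tree × Tree × Tree

  genLC : Gen → LC
  genLC (a , C , R , s , t , u) =
    map (λ { (b , v) → (a * b , plug C v) }) (relator R s t u)

  -- p lies in the ideal generated by the relations, i.e. p = 0 in the
  -- free dendriform trialgebra on x
  InIdeal : LC → Set (c Level.⊔ ℓ)
  InIdeal p = ∃ λ (gs : List Gen) → ∀ t → coeff p t ≈ coeff (concatMap genLC gs) t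

  evalT : Tree → Ser
  evalT x            = M₁
  evalT (node o s t) = prod o (evalT s) (evalT t)

  evalLC : LC → Ser
  evalLC []            w = 0#
  evalLC ((a , t) ∷ p) w = a * evalT t w + evalLC p w

-- Evaluation at M₁ kills the relations: both sides of a relation expand into sums over the
-- factorisations w = u₁ u₂ v, a term being selected according to the relative order of
-- max u₁, max u₂ and max v alone, so each relation is a finite check over 13 cases.
-- Modulo the relations every monomial in x is a combination of normal forms
--   e ::= k | e ▷ k,   k ::= a | a ∘ k,   a ::= x | x ◁ e,
-- whose products are computed by reading the relations as rewrite rules.  Evaluated at M₁,
-- a normal form is the sum of the words of a language, decided by cutting a word before the
-- first occurrence of its maximum (for ▷) or of its first letter (for ∘); each language
-- contains a word lying in no other one.  So the images of the normal forms are linearly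
-- independent, and a combination vanishing at M₁ is, modulo the relations, zero.

module Submission where

open import Defs
import Level
open Level using (Level)
open import Data.Bool using (Bool; true; false; _∧_)
open import Data.Bool.Properties using (∧-conicalˡ; ∧-conicalʳ; ∧-zeroʳ)
open import Data.Empty using (⊥-elim)
open import Data.List using (List; []; _∷_; map; concatMap; _++_; length)
open import Data.List.Properties using (map-++; map-∘; map-cong; map-id; concatMap-++; ++-assoc)
open import Data.List.Membership.Propositional using (_∈_)
open import Data.List.Relation.Unary.All as All using (All; []; _∷_; all?)
open import Data.Maybe as Maybe using (Maybe; just; nothing; maybe′)
open import Data.Nat using (ℕ; suc; _⊔_; _<_; _≤_; _≟_; z≤n; s≤s)
open import Data.Nat.Properties
  using (<-cmp; <-irrefl; <-asym; <-trans; ≤-<-trans; <⇒≤; ≤-refl; ≤-reflexive; ≤-trans; m≤n⇒m≤1+n;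
         ⊔-assoc; ⊔-idem; m≤m⊔n; m≤n⊔m; m≤n⇒m⊔n≡n; m≥n⇒m⊔n≡m; m⊔n≤o⇒m≤o; m⊔n≤o⇒n≤o)
open import Data.Product using (Σ; ∃; _×_; _,_; proj₁; proj₂; uncurry; map₂)
open import Data.Product.Properties using (≡-dec)
open import Data.Sum using (_⊎_; inj₁; inj₂)
open import Function.Definitions using (Injective)
open import Relation.Binary.Definitions using (DecidableEquality; tri<; tri≈; tri>)
open import Relation.Binary.PropositionalEquality as ≡ using (_≡_; _≢_)
open import Relation.Nullary using (¬_; Dec; yes; no)
open import Relation.Nullary.Decidable using (True; toWitness; from-yes)

module Comparisons where
  open ≡ using (refl; sym)

  data Cmp : Set where
    LT EQ GT : Cmp

  _≟ᶜ_ : DecidableEquality Cmp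
  LT ≟ᶜ LT = yes refl
  LT ≟ᶜ EQ = no λ ()
  LT ≟ᶜ GT = no λ ()
  EQ ≟ᶜ LT = no λ ()
  EQ ≟ᶜ EQ = yes refl
  EQ ≟ᶜ GT = no λ ()
  GT ≟ᶜ LT = no λ ()
  GT ≟ᶜ EQ = no λ ()
  GT ≟ᶜ GT = yes refl

  compare : ℕ → ℕ → Cmp
  compare m n with <-cmp m n
  ... | tri< _ _ _ = LT
  ... | tri≈ _ _ _ = EQ
  ... | tri> _ _ _ = GT

  compare-< : ∀ {m n} → m < n → compare m n ≡ LT
  compare-< {m} {n} m<n with <-cmp m n
  ... | tri< _ _ _   = refl
  ... | tri≈ _ m≡n _ = ⊥-elim (<-irrefl m≡n m<n)
  ... | tri> _ _ n<m = ⊥-elim (<-asym m<n n<m)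

  compare-≡ : ∀ {m n} → m ≡ n → compare m n ≡ EQ
  compare-≡ {m} {n} m≡n with <-cmp m n
  ... | tri< m<n _ _ = ⊥-elim (<-irrefl m≡n m<n)
  ... | tri≈ _ _ _   = refl
  ... | tri> _ _ n<m = ⊥-elim (<-irrefl (sym m≡n) n<m)

  compare-> : ∀ {m n} → n < m → compare m n ≡ GT
  compare-> {m} {n} n<m with <-cmp m n
  ... | tri< m<n _ _ = ⊥-elim (<-asym m<n n<m)
  ... | tri≈ _ m≡n _ = ⊥-elim (<-irrefl (sym m≡n) n<m)
  ... | tri> _ _ _   = refl

  holds : Op → Cmp → Bool
  holds ◁ GT = true
  holds ∘ EQ = true
  holds ▷ LT = true
  holds _ _  = false

  holds-▷ : ∀ a c → holds ▷ (compare a c) ≡ true → a < c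
  holds-▷ a c _  with <-cmp a c
  holds-▷ a c _  | tri< a<c _ _ = a<c
  holds-▷ a c () | tri≈ _ _ _
  holds-▷ a c () | tri> _ _ _

  holds-∘ : ∀ a c → holds ∘ (compare a c) ≡ true → a ≡ c
  holds-∘ a c _  with <-cmp a c
  holds-∘ a c () | tri< _ _ _
  holds-∘ a c _  | tri≈ _ a≡c _ = a≡c
  holds-∘ a c () | tri> _ _ _

  holds-◁ : ∀ a c → holds ◁ (compare a c) ≡ true → c < a
  holds-◁ a c _  with <-cmp a c
  holds-◁ a c () | tri< _ _ _
  holds-◁ a c () | tri≈ _ _ _
  holds-◁ a c _  | tri> _ _ c<a = c<a

  compareJoinˡ : Cmp → Cmp → Cmp → Cmp
  compareJoinˡ LT ac bc = bc
  compareJoinˡ EQ ac bc = ac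
  compareJoinˡ GT ac bc = ac

  compareJoinʳ : Cmp → Cmp → Cmp → Cmp
  compareJoinʳ LT ab ac = ac
  compareJoinʳ EQ ab ac = ab
  compareJoinʳ GT ab ac = ab

  compare-⊔ˡ : ∀ a b c → compare (a ⊔ b) c ≡ compareJoinˡ (compare a b) (compare a c) (compare b c)
  compare-⊔ˡ a b c with <-cmp a b
  ... | tri< a<b _ _ rewrite m≤n⇒m⊔n≡n (<⇒≤ a<b) = refl
  ... | tri≈ _ a≡b _ rewrite m≥n⇒m⊔n≡m (≤-reflexive (sym a≡b)) = refl
  ... | tri> _ _ b<a rewrite m≥n⇒m⊔n≡m (<⇒≤ b<a) = refl

  compare-⊔ʳ : ∀ a b c → compare a (b ⊔ c) ≡ compareJoinʳ (compare b c) (compare a b) (compare a c)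
  compare-⊔ʳ a b c with <-cmp b c
  ... | tri< b<c _ _ rewrite m≤n⇒m⊔n≡n (<⇒≤ b<c) = refl
  ... | tri≈ _ b≡c _ rewrite m≥n⇒m⊔n≡m (≤-reflexive (sym b≡c)) = refl
  ... | tri> _ _ c<b rewrite m≥n⇒m⊔n≡m (<⇒≤ c<b) = refl

  Cmp³ : Set
  Cmp³ = Cmp × Cmp × Cmp

  _≟³_ : DecidableEquality Cmp³
  _≟³_ = ≡-dec _≟ᶜ_ (≡-dec _≟ᶜ_ _≟ᶜ_)

  open import Data.List.Membership.DecPropositional _≟³_ using (_∈?_)

  compare³ : ℕ → ℕ → ℕ → Cmp³
  compare³ a b c = compare a b , compare b c , compare a c

  -- the 13 weak orderings of three elements, as (a vs b, b vs c, a vs c)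
  consistentTriples : List Cmp³
  consistentTriples =
    (LT , LT , LT) ∷ (LT , EQ , LT) ∷ (LT , GT , LT) ∷ (LT , GT , EQ) ∷ (LT , GT , GT) ∷
    (EQ , LT , LT) ∷ (EQ , EQ , EQ) ∷ (EQ , GT , GT) ∷
    (GT , LT , LT) ∷ (GT , LT , EQ) ∷ (GT , LT , GT) ∷ (GT , EQ , GT) ∷ (GT , GT , GT) ∷ []

  listed : ∀ {t} {t∈? : True (t ∈? consistentTriples)} → t ∈ consistentTriples
  listed {t∈? = t∈?} = toWitness t∈?

  compare³-consistent : ∀ a b c → compare³ a b c ∈ consistentTriples
  compare³-consistent a b c with <-cmp a b | <-cmp b c
  ... | tri< a<b _ _ | tri< b<c _ _ rewrite compare-< (<-trans a<b b<c) = listed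
  ... | tri< a<b _ _ | tri≈ _ refl _ rewrite compare-< a<b = listed
  ... | tri≈ _ refl _ | tri< b<c _ _ rewrite compare-< b<c = listed
  ... | tri≈ _ refl _ | tri≈ _ refl _ rewrite compare-≡ {a} refl = listed
  ... | tri≈ _ refl _ | tri> _ _ c<b rewrite compare-> c<b = listed
  ... | tri> _ _ b<a | tri≈ _ refl _ rewrite compare-> b<a = listed
  ... | tri> _ _ b<a | tri> _ _ c<b rewrite compare-> (<-trans c<b b<a) = listed
  ... | tri< _ _ _ | tri> _ _ _ with <-cmp a c
  ...   | tri< _ _ _ = listed
  ...   | tri≈ _ _ _ = listed
  ...   | tri> _ _ _ = listed
  compare³-consistent a b c | tri> _ _ _ | tri< _ _ _ with <-cmp a c
  ...   | tri< _ _ _ = listed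
  ...   | tri≈ _ _ _ = listed
  ...   | tri> _ _ _ = listed


open Comparisons

module Bracketings where
  -- Whether (s o t) o′ u, resp. s o (t o′ u), evaluated at M₁ contains the word u₁ u₂ v,
  -- given the comparisons (max u₁ vs max u₂, max u₂ vs max v, max u₁ vs max v).
  leftHolds : Op × Op → Cmp³ → Bool
  leftHolds (o , o′) (ab , bc , ac) = holds o′ (compareJoinˡ ab ac bc) ∧ holds o ab

  rightHolds : Op × Op → Cmp³ → Bool
  rightHolds (o , o′) (ab , bc , ac) = holds o (compareJoinʳ bc ab ac) ∧ holds o′ bc

  trues : List Bool → ℕ
  trues []           = 0
  trues (true ∷ bs)  = suc (trues bs)
  trues (false ∷ bs) = trues bs

  -- The bracketings (s o t) o′ u for (o , o′) ∈ L and s o (t o′ u) for (o , o′) ∈ R select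
  -- every term u₁ u₂ v equally often.
  BracketingsAgree : List (Op × Op) → List (Op × Op) → Set
  BracketingsAgree L R =
    All (λ t → trues (map (λ p → leftHolds p t) L) ≡ trues (map (λ p → rightHolds p t) R)) consistentTriples

  bracketingsAgree? : ∀ L R → Dec (BracketingsAgree L R)
  bracketingsAgree? L R =
    all? (λ t → trues (map (λ p → leftHolds p t) L) ≟ trues (map (λ p → rightHolds p t) R)) consistentTriples

  -- relator R s t u is  Σ_{(o , o′) ∈ lhsOps R} (s o t) o′ u  −  Σ_{(o , o′) ∈ rhsOps R} s o (t o′ u).
  lhsOps : Rel → List (Op × Op)
  lhsOps assoc∘ = (∘ , ∘) ∷ []
  lhsOps r◁◁    = (◁ , ◁) ∷ []
  lhsOps r▷◁    = (▷ , ◁) ∷ []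
  lhsOps r⊙▷    = (◁ , ▷) ∷ (∘ , ▷) ∷ (▷ , ▷) ∷ []
  lhsOps r▷∘    = (▷ , ∘) ∷ []
  lhsOps r◁∘    = (◁ , ∘) ∷ []
  lhsOps r∘◁    = (∘ , ◁) ∷ []

  rhsOps : Rel → List (Op × Op)
  rhsOps assoc∘ = (∘ , ∘) ∷ []
  rhsOps r◁◁    = (◁ , ◁) ∷ (◁ , ∘) ∷ (◁ , ▷) ∷ []
  rhsOps r▷◁    = (▷ , ◁) ∷ []
  rhsOps r⊙▷    = (▷ , ▷) ∷ []
  rhsOps r▷∘    = (▷ , ∘) ∷ []
  rhsOps r◁∘    = (∘ , ▷) ∷ []
  rhsOps r∘◁    = (∘ , ◁) ∷ []

  relator-bracketingsAgree : ∀ R → BracketingsAgree (lhsOps R) (rhsOps R)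
  relator-bracketingsAgree assoc∘  = from-yes (bracketingsAgree? (lhsOps assoc∘) (rhsOps assoc∘))
  relator-bracketingsAgree r◁◁     = from-yes (bracketingsAgree? (lhsOps r◁◁) (rhsOps r◁◁))
  relator-bracketingsAgree r▷◁     = from-yes (bracketingsAgree? (lhsOps r▷◁) (rhsOps r▷◁))
  relator-bracketingsAgree r⊙▷     = from-yes (bracketingsAgree? (lhsOps r⊙▷) (rhsOps r⊙▷))
  relator-bracketingsAgree r▷∘     = from-yes (bracketingsAgree? (lhsOps r▷∘) (rhsOps r▷∘))
  relator-bracketingsAgree r◁∘     = from-yes (bracketingsAgree? (lhsOps r◁∘) (rhsOps r◁∘))
  relator-bracketingsAgree r∘◁     = from-yes (bracketingsAgree? (lhsOps r∘◁) (rhsOps r∘◁))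

open Bracketings

module Words where
  open ≡ using (refl; sym; trans; cong)

  Word⁺ : Set
  Word⁺ = ℕ × List ℕ

  toWord : Word⁺ → Word
  toWord (a , as) = a ∷ as

  max⁺ : Word⁺ → ℕ
  max⁺ (a , as) = maxW a as

  maxW-upperBound : ∀ a as → All (_≤ maxW a as) (a ∷ as)
  maxW-upperBound a []       = ≤-refl ∷ []
  maxW-upperBound a (b ∷ bs) =
    m≤m⊔n a (maxW b bs) ∷ All.map (λ le → ≤-trans le (m≤n⊔m a (maxW b bs))) (maxW-upperBound b bs)

  maxW-++ : ∀ a as b bs → maxW a (as ++ b ∷ bs) ≡ maxW a as ⊔ maxW b bs
  maxW-++ a []       b bs = refl
  maxW-++ a (c ∷ cs) b bs = trans (cong (a ⊔_) (maxW-++ c cs b bs)) (sym (⊔-assoc a (maxW c cs) (maxW b bs)))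

  all-≢-of-< : ∀ {m k} {us} → All (_≤ k) us → k < m → All (_≢ m) us
  all-≢-of-< us≤k k<m = All.map (λ u≤k u≡m → <-irrefl u≡m (≤-<-trans u≤k k<m)) us≤k

  splitBefore : ℕ → ℕ → List ℕ → Maybe (Word⁺ × Word⁺)
  splitBefore m h []       = nothing
  splitBefore m h (y ∷ ys) with y ≟ m
  ... | yes _ = just ((h , []) , (y , ys))
  ... | no  _ = Maybe.map (λ { ((u , us) , V) → ((h , u ∷ us) , V) }) (splitBefore m y ys)

  splitBefore-just : ∀ m h t {U V} → splitBefore m h t ≡ just (U , V) →
                     proj₁ U ≡ h × maxW h t ≡ max⁺ U ⊔ max⁺ V × proj₁ V ≡ m
  splitBefore-just m h []       ()
  splitBefore-just m h (y ∷ ys) eq with y ≟ m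
  splitBefore-just m h (y ∷ ys) refl | yes y≡m = refl , refl , y≡m
  ... | no _ with splitBefore m y ys in split-ys
  splitBefore-just m h (y ∷ ys) refl | no _ | just ((u , us) , V)
    with refl , max≡ , V≡m ← splitBefore-just m y ys split-ys =
    refl , trans (cong (h ⊔_) max≡) (sym (⊔-assoc h (maxW y us) (max⁺ V))) , V≡m

  splitBefore-just⇒occurs : ∀ m h t {UV} → splitBefore m h t ≡ just UV → ¬ All (_≢ m) t
  splitBefore-just⇒occurs m h []       ()
  splitBefore-just⇒occurs m h (y ∷ ys) eq with y ≟ m
  ... | yes y≡m = λ { (y≢m ∷ _) → y≢m y≡m }
  ... | no _ with splitBefore m y ys in split-ys
  ... | just _ = λ { (_ ∷ ys≢m) → splitBefore-just⇒occurs m y ys split-ys ys≢m }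

  splitBefore-first : ∀ m h us vs → All (_≢ m) us → splitBefore m h (us ++ m ∷ vs) ≡ just ((h , us) , (m , vs))
  splitBefore-first m h []       vs []  with m ≟ m
  ... | yes _   = refl
  ... | no  m≢m = ⊥-elim (m≢m refl)
  splitBefore-first m h (u ∷ us) vs (u≢m ∷ us≢m) with u ≟ m
  ... | yes u≡m = ⊥-elim (u≢m u≡m)
  ... | no  _   rewrite splitBefore-first m u us vs us≢m = refl

open Words

module NormalForms where
  open ≡ using (refl; sym; trans; cong; cong₂; subst; module ≡-Reasoning)

  mutual
    data Nf : Set where
      chain : Chain → Nf
      _▷ₙ_  : Nf → Chain → Nf

    data Chain : Set where
      atom : Atom → Chain
      _∘ₙ_ : Atom → Chain → Chain

    data Atom : Set where
      gen  : Atom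
      gen◁ : Nf → Atom

  mutual
    ⟦_⟧ : Nf → Tree
    ⟦ chain k ⟧ = ⟦ k ⟧ᶜ
    ⟦ e ▷ₙ k ⟧  = node ▷ ⟦ e ⟧ ⟦ k ⟧ᶜ

    ⟦_⟧ᶜ : Chain → Tree
    ⟦ atom a ⟧ᶜ  = ⟦ a ⟧ᵃ
    ⟦ a ∘ₙ k ⟧ᶜ  = node ∘ ⟦ a ⟧ᵃ ⟦ k ⟧ᶜ

    ⟦_⟧ᵃ : Atom → Tree
    ⟦ gen ⟧ᵃ    = x
    ⟦ gen◁ e ⟧ᵃ = node ◁ x ⟦ e ⟧

  _++ᶜ_ : Chain → Chain → Chain
  atom a   ++ᶜ l = a ∘ₙ l
  (a ∘ₙ k) ++ᶜ l = a ∘ₙ (k ++ᶜ l)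

  mutual
    mul⊙ : Nf → Nf → List Nf
    mul⊙ e f = mul◁ e f ++ mul∘ e f ++ mul▷ e f

    mul◁ : Nf → Nf → List Nf
    mul◁ (chain k) f = map chain (chain◁ k f)
    mul◁ (e ▷ₙ k) f  = map (e ▷ₙ_) (chain◁ k f)

    chain◁ : Chain → Nf → List Chain
    chain◁ (atom gen) f      = atom (gen◁ f) ∷ []
    chain◁ (atom (gen◁ e)) f = map (λ g → atom (gen◁ g)) (mul⊙ e f)
    chain◁ (a ∘ₙ k) f        = map (a ∘ₙ_) (chain◁ k f)

    mul∘ : Nf → Nf → List Nf
    mul∘ (chain k) f = map chain (chain∘ k f)
    mul∘ (e ▷ₙ k) f  = map (e ▷ₙ_) (chain∘ k f)

    chain∘ : Chain → Nf → List Chain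
    chain∘ k (chain l) = k ++ᶜ l ∷ []
    chain∘ k (f ▷ₙ l)  = map (_++ᶜ l) (chain◁ k f)

    mul▷ : Nf → Nf → List Nf
    mul▷ e (chain l) = e ▷ₙ l ∷ []
    mul▷ e (f ▷ₙ l)  = map (_▷ₙ l) (mul⊙ e f)

  mulNf : Op → Nf → Nf → List Nf
  mulNf ◁ = mul◁
  mulNf ∘ = mul∘
  mulNf ▷ = mul▷

  productMatch : Op → (Word → Bool) → (Word → Bool) → Word⁺ → Word⁺ → Bool
  productMatch o p q U V = holds o (compare (max⁺ U) (max⁺ V)) ∧ (p (toWord U) ∧ q (toWord V))

  productMatch-true : ∀ o p q U V → productMatch o p q U V ≡ true →
                      holds o (compare (max⁺ U) (max⁺ V)) ≡ true × p (toWord U) ≡ true × q (toWord V) ≡ true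
  productMatch-true o p q U V match =
    ∧-conicalˡ H PQ match , ∧-conicalˡ P Q (∧-conicalʳ H PQ match) , ∧-conicalʳ P Q (∧-conicalʳ H PQ match)
    where
    H = holds o (compare (max⁺ U) (max⁺ V))
    P = p (toWord U)
    Q = q (toWord V)
    PQ = P ∧ Q

  atSplit : (Word⁺ → Word⁺ → Bool) → Maybe (Word⁺ × Word⁺) → Bool
  atSplit P = maybe′ (uncurry P) false

  -- Evaluated at M₁, ⟦ e ⟧ is the sum of the words matching e (evalT-nf).  A word of x ◁ e is a
  -- letter followed by a smaller word of e; a word of a ∘-chain is a concatenation of atom words
  -- whose first letters are their (common) maximum; a word of e ▷ k is cut just before the first
  -- occurrence of its maximum into a word of e and a word of k.
  mutual
    matches : Nf → Word → Bool
    matches (chain k) w      = matchesᶜ k w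
    matches (e ▷ₙ k) []      = false
    matches (e ▷ₙ k) (h ∷ t) = atSplit (productMatch ▷ (matches e) (matchesᶜ k)) (splitBefore (maxW h t) h t)

    matchesᶜ : Chain → Word → Bool
    matchesᶜ (atom a) w       = matchesᵃ a w
    matchesᶜ (a ∘ₙ k) []      = false
    matchesᶜ (a ∘ₙ k) (h ∷ t) = atSplit (productMatch ∘ (matchesᵃ a) (matchesᶜ k)) (splitBefore h h t)

    matchesᵃ : Atom → Word → Bool
    matchesᵃ gen      (_ ∷ [])     = true
    matchesᵃ (gen◁ e) (h ∷ y ∷ ys) = holds ◁ (compare h (maxW y ys)) ∧ matches e (y ∷ ys)
    matchesᵃ _        _            = false

  atSplit-true : ∀ P ms → atSplit P ms ≡ true → Σ (Word⁺ × Word⁺) λ UV → ms ≡ just UV × uncurry P UV ≡ true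
  atSplit-true P (just UV) match = UV , refl , match

  atom-shape : ∀ a u us → matchesᵃ a (u ∷ us) ≡ true → All (_≢ u) us × maxW u us ≡ u
  atom-shape gen      u []       _     = [] , refl
  atom-shape (gen◁ e) u (y ∷ ys) match =
    all-≢-of-< (maxW-upperBound y ys) max<u , m≥n⇒m⊔n≡m (<⇒≤ max<u)
    where max<u = holds-◁ u (maxW y ys) (∧-conicalˡ _ (matches e (y ∷ ys)) match)

  chain-max : ∀ k v vs → matchesᶜ k (v ∷ vs) ≡ true → maxW v vs ≡ v
  chain-max (atom a) v vs match = proj₂ (atom-shape a v vs match)
  chain-max (a ∘ₙ k) v vs match
    with ((_ , us) , V) , split , pm ← atSplit-true _ (splitBefore v v vs) match
    with refl , max≡ , _ ← splitBefore-just v v vs split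
    with same , matchU , _ ← productMatch-true ∘ (matchesᵃ a) (matchesᶜ k) (v , us) V pm = begin
      maxW v vs              ≡⟨ max≡ ⟩
      maxW v us ⊔ max⁺ V     ≡⟨ cong (maxW v us ⊔_) (holds-∘ (maxW v us) (max⁺ V) same) ⟨
      maxW v us ⊔ maxW v us  ≡⟨ ⊔-idem (maxW v us) ⟩
      maxW v us              ≡⟨ proj₂ (atom-shape a v us matchU) ⟩
      v                      ∎
    where open ≡-Reasoning

  ▷-max≢head : ∀ e k h t → matches (e ▷ₙ k) (h ∷ t) ≡ true → maxW h t ≢ h
  ▷-max≢head e k h t match max≡h
    with ((_ , us) , V) , split , pm ← atSplit-true _ (splitBefore (maxW h t) h t) match
    with refl , max≡ , _ ← splitBefore-just (maxW h t) h t split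
    with U▷V , _ ← productMatch-true ▷ (matches e) (matchesᶜ k) (h , us) V pm =
    <-irrefl refl (≤-<-trans (All.head (maxW-upperBound h us)) (subst (maxW h us <_) V≡h U<V))
    where
    U<V : maxW h us < max⁺ V
    U<V = holds-▷ (maxW h us) (max⁺ V) U▷V
    V≡h : max⁺ V ≡ h
    V≡h = trans (sym (trans max≡ (m≤n⇒m⊔n≡n (<⇒≤ U<V)))) max≡h

  mutual
    matches-unique : ∀ e e′ w → matches e w ≡ true → matches e′ w ≡ true → e ≡ e′
    matches-unique (chain k) (chain k′) w match match′ = cong chain (matchesᶜ-unique k k′ w match match′)
    matches-unique (chain k) (e′ ▷ₙ k′) (h ∷ t) match match′ =
      ⊥-elim (▷-max≢head e′ k′ h t match′ (chain-max k h t match))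
    matches-unique (e ▷ₙ k) (chain k′) (h ∷ t) match match′ =
      ⊥-elim (▷-max≢head e k h t match (chain-max k′ h t match′))
    matches-unique (e ▷ₙ k) (e′ ▷ₙ k′) (h ∷ t) match match′ with splitBefore (maxW h t) h t
    ... | just (U , V)
      with _ , matchU , matchV ← productMatch-true ▷ (matches e) (matchesᶜ k) U V match
      with _ , matchU′ , matchV′ ← productMatch-true ▷ (matches e′) (matchesᶜ k′) U V match′ =
      cong₂ _▷ₙ_ (matches-unique e e′ (toWord U) matchU matchU′) (matchesᶜ-unique k k′ (toWord V) matchV matchV′)

    matchesᶜ-unique : ∀ k k′ w → matchesᶜ k w ≡ true → matchesᶜ k′ w ≡ true → k ≡ k′
    matchesᶜ-unique (atom a) (atom a′) w match match′ = cong atom (matchesᵃ-unique a a′ w match match′)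
    matchesᶜ-unique (atom a) (a′ ∘ₙ k′) (h ∷ t) match match′
      with _ , split , _ ← atSplit-true _ (splitBefore h h t) match′ =
      ⊥-elim (splitBefore-just⇒occurs h h t split (proj₁ (atom-shape a h t match)))
    matchesᶜ-unique (a ∘ₙ k) (atom a′) (h ∷ t) match match′
      with _ , split , _ ← atSplit-true _ (splitBefore h h t) match =
      ⊥-elim (splitBefore-just⇒occurs h h t split (proj₁ (atom-shape a′ h t match′)))
    matchesᶜ-unique (a ∘ₙ k) (a′ ∘ₙ k′) (h ∷ t) match match′ with splitBefore h h t
    ... | just (U , V)
      with _ , matchU , matchV ← productMatch-true ∘ (matchesᵃ a) (matchesᶜ k) U V match
      with _ , matchU′ , matchV′ ← productMatch-true ∘ (matchesᵃ a′) (matchesᶜ k′) U V match′ =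
      cong₂ _∘ₙ_ (matchesᵃ-unique a a′ (toWord U) matchU matchU′) (matchesᶜ-unique k k′ (toWord V) matchV matchV′)

    matchesᵃ-unique : ∀ a a′ w → matchesᵃ a w ≡ true → matchesᵃ a′ w ≡ true → a ≡ a′
    matchesᵃ-unique gen      gen       w            _     _      = refl
    matchesᵃ-unique gen      (gen◁ _)  (_ ∷ [])     _     ()
    matchesᵃ-unique (gen◁ _) gen       (_ ∷ [])     ()    _
    matchesᵃ-unique (gen◁ e) (gen◁ e′) (h ∷ y ∷ ys) match match′ =
      cong gen◁ (matches-unique e e′ (y ∷ ys) (∧-conicalʳ _ _ match) (∧-conicalʳ _ _ match′))

  ∘ₙ-matches : ∀ a k m us vs → maxW m us ≡ m → maxW m vs ≡ m →
               matchesᵃ a (m ∷ us) ≡ true → matchesᶜ k (m ∷ vs) ≡ true →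
               matchesᶜ (a ∘ₙ k) (m ∷ us ++ m ∷ vs) ≡ true
  ∘ₙ-matches a k m us vs maxA maxK matchA matchK
    rewrite splitBefore-first m m us vs (proj₁ (atom-shape a m us matchA))
          | maxA | maxK | compare-≡ {m} refl | matchA | matchK = refl

  ▷ₙ-matches : ∀ e k h hs m vs → maxW h hs < m → maxW m vs ≡ m →
               matches e (h ∷ hs) ≡ true → matchesᶜ k (m ∷ vs) ≡ true → matches (e ▷ₙ k) (h ∷ hs ++ m ∷ vs) ≡ true
  ▷ₙ-matches e k h hs m vs e<m maxK matchE matchK
    rewrite maxW-++ h hs m vs | maxK | m≤n⇒m⊔n≡n (<⇒≤ e<m)
          | splitBefore-first m h hs vs (all-≢-of-< (All.tail (maxW-upperBound h hs)) e<m)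
          | maxK | compare-< e<m | matchE | matchK = refl

  _⁺++_ : Word⁺ → List ℕ → Word⁺
  (a , as) ⁺++ w = (a , as ++ w)

  -- witness e is a word matching e; witnessᶜ k m and witnessᵃ a m are the tails of words
  -- matching k and a that begin with the letter m, which must be at least floorᶜ k, floorᵃ a.
  mutual
    witness : Nf → Word⁺
    witness (chain k) = floorᶜ k , witnessᶜ k (floorᶜ k)
    witness (e ▷ₙ k)  = witness e ⁺++ (m ∷ witnessᶜ k m)
      where m = floorᶜ k ⊔ suc (max⁺ (witness e))

    witnessᶜ : Chain → ℕ → List ℕ
    witnessᶜ (atom a) m = witnessᵃ a m
    witnessᶜ (a ∘ₙ k) m = witnessᵃ a m ++ m ∷ witnessᶜ k m

    witnessᵃ : Atom → ℕ → List ℕ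
    witnessᵃ gen      m = []
    witnessᵃ (gen◁ e) m = toWord (witness e)

    floorᶜ : Chain → ℕ
    floorᶜ (atom a) = floorᵃ a
    floorᶜ (a ∘ₙ k) = floorᵃ a ⊔ floorᶜ k

    floorᵃ : Atom → ℕ
    floorᵃ gen      = 0
    floorᵃ (gen◁ e) = suc (max⁺ (witness e))

  mutual
    witnessᵃ-matches : ∀ a m → floorᵃ a ≤ m → matchesᵃ a (m ∷ witnessᵃ a m) ≡ true × maxW m (witnessᵃ a m) ≡ m
    witnessᵃ-matches gen      m _     = refl , refl
    witnessᵃ-matches (gen◁ e) m max<m rewrite compare-> max<m | witness-matches e =
      refl , m≥n⇒m⊔n≡m (<⇒≤ max<m)

    witnessᶜ-matches : ∀ k m → floorᶜ k ≤ m → matchesᶜ k (m ∷ witnessᶜ k m) ≡ true × maxW m (witnessᶜ k m) ≡ m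
    witnessᶜ-matches (atom a) m floor≤m = witnessᵃ-matches a m floor≤m
    witnessᶜ-matches (a ∘ₙ k) m floor≤m
      with matchA , maxA ← witnessᵃ-matches a m (m⊔n≤o⇒m≤o (floorᵃ a) (floorᶜ k) floor≤m)
      with matchK , maxK ← witnessᶜ-matches k m (m⊔n≤o⇒n≤o (floorᵃ a) (floorᶜ k) floor≤m) =
      ∘ₙ-matches a k m _ _ maxA maxK matchA matchK ,
      trans (maxW-++ m (witnessᵃ a m) m (witnessᶜ k m)) (trans (cong₂ _⊔_ maxA maxK) (⊔-idem m))

    witness-matches : ∀ e → matches e (toWord (witness e)) ≡ true
    witness-matches (chain k) = proj₁ (witnessᶜ-matches k (floorᶜ k) ≤-refl)
    witness-matches (e ▷ₙ k) =
      ▷ₙ-matches e k h hs m (witnessᶜ k m) e<m (proj₂ matchK) (witness-matches e) (proj₁ matchK)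
      where
      h  = proj₁ (witness e)
      hs = proj₂ (witness e)
      m  = floorᶜ k ⊔ suc (maxW h hs)
      e<m : maxW h hs < m
      e<m = m≤n⊔m (floorᶜ k) (suc (maxW h hs))
      matchK = witnessᶜ-matches k m (m≤m⊔n (floorᶜ k) (suc (maxW h hs)))

  matches-witness⇒≡ : ∀ e f → matches e (toWord (witness f)) ≡ true → e ≡ f
  matches-witness⇒≡ e f match = matches-unique e f (toWord (witness f)) match (witness-matches f)

open NormalForms

module Ideal {c ℓ : Level} (K : Field c ℓ) where
  open Field K
  open FreeTri K
  open import Algebra.Properties.Ring ring using (-1*x≈-x; -0#≈0#; -‿+-comm)
  open import Algebra.Properties.CommutativeSemigroup +-commutativeSemigroup using (interchange)
  open import Relation.Binary.Reasoning.Setoid setoid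

  gens : List Gen → LC
  gens = concatMap genLC

  scaleLC : Carrier → LC → LC
  scaleLC a = map (λ { (b , s) → (a * b , s) })

  scaleGen : Carrier → Gen → Gen
  scaleGen a (b , rest) = (a * b , rest)

  mapTrees : (Tree → Tree) → LC → LC
  mapTrees f = map (map₂ f)

  coeff-++ : ∀ p q t → coeff (p ++ q) t ≈ coeff p t + coeff q t
  coeff-++ []            q t = sym (+-identityˡ _)
  coeff-++ ((a , s) ∷ p) q t with s ≟T t
  ... | yes _ = trans (+-congˡ (coeff-++ p q t)) (sym (+-assoc _ _ _))
  ... | no  _ = coeff-++ p q t

  coeff-scaleLC : ∀ a p t → coeff (scaleLC a p) t ≈ a * coeff p t
  coeff-scaleLC a []            t = sym (zeroʳ a)
  coeff-scaleLC a ((b , s) ∷ p) t with s ≟T t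
  ... | yes _ = trans (+-congˡ (coeff-scaleLC a p t)) (sym (distribˡ a b _))
  ... | no  _ = coeff-scaleLC a p t

  coeff-neg : ∀ p t → coeff (neg p) t ≈ - coeff p t
  coeff-neg []            t = sym -0#≈0#
  coeff-neg ((b , s) ∷ p) t with s ≟T t
  ... | yes _ = trans (+-congˡ (coeff-neg p t)) (-‿+-comm b (coeff p t))
  ... | no  _ = coeff-neg p t

  coeff-genLC-scaleGen : ∀ a g t → coeff (genLC (scaleGen a g)) t ≈ a * coeff (genLC g) t
  coeff-genLC-scaleGen a (b , C , R , s , s′ , s″) t = coeff-scaled (relator R s s′ s″)
    where
    coeff-scaled : ∀ (L : LC) → coeff (map (λ { (d , v) → ((a * b) * d , plug C v) }) L) t
             ≈ a * coeff (map (λ { (d , v) → (b * d , plug C v) }) L) t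
    coeff-scaled []            = sym (zeroʳ a)
    coeff-scaled ((d , v) ∷ L) with plug C v ≟T t
    ... | yes _ = trans (+-cong (*-assoc a b d) (coeff-scaled L)) (sym (distribˡ a _ _))
    ... | no  _ = coeff-scaled L

  coeff-gens-++ : ∀ gs hs t → coeff (gens (gs ++ hs)) t ≈ coeff (gens gs) t + coeff (gens hs) t
  coeff-gens-++ gs hs t rewrite concatMap-++ genLC gs hs = coeff-++ (gens gs) (gens hs) t

  coeff-gens-scale : ∀ a gs t → coeff (gens (map (scaleGen a) gs)) t ≈ a * coeff (gens gs) t
  coeff-gens-scale a []       t = sym (zeroʳ a)
  coeff-gens-scale a (g ∷ gs) t = begin
    coeff (genLC (scaleGen a g) ++ gens (map (scaleGen a) gs)) t
      ≈⟨ coeff-++ (genLC (scaleGen a g)) _ t ⟩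
    coeff (genLC (scaleGen a g)) t + coeff (gens (map (scaleGen a) gs)) t
      ≈⟨ +-cong (coeff-genLC-scaleGen a g t) (coeff-gens-scale a gs t) ⟩
    a * coeff (genLC g) t + a * coeff (gens gs) t
      ≈⟨ distribˡ a _ _ ⟨
    a * (coeff (genLC g) t + coeff (gens gs) t)
      ≈⟨ *-congˡ (coeff-++ (genLC g) (gens gs) t) ⟨
    a * coeff (gens (g ∷ gs)) t ∎

  infix 4 _≈ᴵ_

  record _≈ᴵ_ (p q : LC) : Set (c Level.⊔ ℓ) where
    constructor mod
    field
      generators : List Gen
      coeff-≈    : ∀ t → coeff p t ≈ coeff q t + coeff (gens generators) t

  coeff⇒≈ᴵ : ∀ {p q} → (∀ t → coeff p t ≈ coeff q t) → p ≈ᴵ q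
  coeff⇒≈ᴵ p≐q = mod [] λ t → trans (p≐q t) (sym (+-identityʳ _))

  ≡⇒≈ᴵ : ∀ {p q} → p ≡ q → p ≈ᴵ q
  ≡⇒≈ᴵ ≡.refl = coeff⇒≈ᴵ λ _ → refl

  ≈ᴵ-refl : ∀ {p} → p ≈ᴵ p
  ≈ᴵ-refl = ≡⇒≈ᴵ ≡.refl

  ≈ᴵ-trans : ∀ {p q r} → p ≈ᴵ q → q ≈ᴵ r → p ≈ᴵ r
  ≈ᴵ-trans {p} {q} {r} (mod gs p≈q) (mod hs q≈r) = mod (hs ++ gs) λ t → begin
    coeff p t                                                   ≈⟨ p≈q t ⟩
    coeff q t + coeff (gens gs) t                               ≈⟨ +-congʳ (q≈r t) ⟩
    (coeff r t + coeff (gens hs) t) + coeff (gens gs) t         ≈⟨ +-assoc _ _ _ ⟩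
    coeff r t + (coeff (gens hs) t + coeff (gens gs) t)         ≈⟨ +-congˡ (coeff-gens-++ hs gs t) ⟨
    coeff r t + coeff (gens (hs ++ gs)) t                       ∎

  ≈ᴵ-sym : ∀ {p q} → p ≈ᴵ q → q ≈ᴵ p
  ≈ᴵ-sym {p} {q} (mod gs p≈q) = mod (map (scaleGen (- 1#)) gs) λ t → begin
    coeff q t                                                   ≈⟨ +-identityʳ _ ⟨
    coeff q t + 0#                                              ≈⟨ +-congˡ (-‿inverseʳ _) ⟨
    coeff q t + (coeff (gens gs) t + - coeff (gens gs) t)       ≈⟨ +-assoc _ _ _ ⟨
    (coeff q t + coeff (gens gs) t) + - coeff (gens gs) t       ≈⟨ +-cong (p≈q t) (-1*x≈-x _) ⟨
    coeff p t + - 1# * coeff (gens gs) t                        ≈⟨ +-congˡ (coeff-gens-scale (- 1#) gs t) ⟨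
    coeff p t + coeff (gens (map (scaleGen (- 1#)) gs)) t       ∎

  ≈ᴵ-++ : ∀ {p q p′ q′} → p ≈ᴵ p′ → q ≈ᴵ q′ → p ++ q ≈ᴵ p′ ++ q′
  ≈ᴵ-++ {p} {q} {p′} {q′} (mod gs p≈p′) (mod hs q≈q′) = mod (gs ++ hs) λ t → begin
    coeff (p ++ q) t                                                  ≈⟨ coeff-++ p q t ⟩
    coeff p t + coeff q t                                             ≈⟨ +-cong (p≈p′ t) (q≈q′ t) ⟩
    (coeff p′ t + coeff (gens gs) t) + (coeff q′ t + coeff (gens hs) t) ≈⟨ interchange _ _ _ _ ⟩
    (coeff p′ t + coeff q′ t) + (coeff (gens gs) t + coeff (gens hs) t)
      ≈⟨ +-cong (coeff-++ p′ q′ t) (coeff-gens-++ gs hs t) ⟨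
    coeff (p′ ++ q′) t + coeff (gens (gs ++ hs)) t                    ∎

  ≈ᴵ-scale : ∀ a {p q} → p ≈ᴵ q → scaleLC a p ≈ᴵ scaleLC a q
  ≈ᴵ-scale a {p} {q} (mod gs p≈q) = mod (map (scaleGen a) gs) λ t → begin
    coeff (scaleLC a p) t                                       ≈⟨ coeff-scaleLC a p t ⟩
    a * coeff p t                                               ≈⟨ *-congˡ (p≈q t) ⟩
    a * (coeff q t + coeff (gens gs) t)                         ≈⟨ distribˡ a _ _ ⟩
    a * coeff q t + a * coeff (gens gs) t
      ≈⟨ +-cong (coeff-scaleLC a q t) (coeff-gens-scale a gs t) ⟨
    coeff (scaleLC a q) t + coeff (gens (map (scaleGen a) gs)) t ∎

  coeff-mapTrees-image : ∀ {f} → Injective _≡_ _≡_ f → ∀ p t → coeff (mapTrees f p) (f t) ≈ coeff p t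
  coeff-mapTrees-image {f} f-inj []            t = refl
  coeff-mapTrees-image {f} f-inj ((a , s) ∷ p) t with f s ≟T f t | s ≟T t
  ... | yes _      | yes _     = +-congˡ (coeff-mapTrees-image f-inj p t)
  ... | no  _      | no  _     = coeff-mapTrees-image f-inj p t
  ... | yes fs≡ft  | no  s≢t   = ⊥-elim (s≢t (f-inj fs≡ft))
  ... | no  fs≢ft  | yes ≡.refl = ⊥-elim (fs≢ft ≡.refl)

  coeff-mapTrees-outside : ∀ {f t} → (∀ s → f s ≢ t) → ∀ p → coeff (mapTrees f p) t ≈ 0#
  coeff-mapTrees-outside {f} {t} t∉f []            = refl
  coeff-mapTrees-outside {f} {t} t∉f ((a , s) ∷ p) with f s ≟T t
  ... | yes fs≡t = ⊥-elim (t∉f s fs≡t)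
  ... | no  _    = coeff-mapTrees-outside t∉f p

  extendGen : (Ctx → Ctx) → Gen → Gen
  extendGen E (a , C , rest) = (a , E C , rest)

  gens-extend : ∀ E f → (∀ C v → plug (E C) v ≡ f (plug C v)) →
                ∀ gs → gens (map (extendGen E) gs) ≡ mapTrees f (gens gs)
  gens-extend E f plug-E []       = ≡.refl
  gens-extend E f plug-E (g ∷ gs) = ≡.trans (≡.cong₂ _++_ (genLC-extend g) (gens-extend E f plug-E gs))
                                            (≡.sym (map-++ (map₂ f) (genLC g) (gens gs)))
    where
    genLC-extend : ∀ g → genLC (extendGen E g) ≡ mapTrees f (genLC g)
    genLC-extend (a , C , R , s , s′ , s″) =
      ≡.trans (map-cong (λ { (b , v) → ≡.cong (a * b ,_) (plug-E C v) }) (relator R s s′ s″))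
              (map-∘ (relator R s s′ s″))

  ≈ᴵ-context : ∀ E f → (∀ C v → plug (E C) v ≡ f (plug C v)) → Injective _≡_ _≡_ f →
               (∀ t → Dec (∃ λ s → f s ≡ t)) → ∀ {p q} → p ≈ᴵ q → mapTrees f p ≈ᴵ mapTrees f q
  ≈ᴵ-context E f plug-E f-inj image? {p} {q} (mod gs p≈q) = mod (map (extendGen E) gs) λ t →
    ≡.subst (λ G → coeff (mapTrees f p) t ≈ coeff (mapTrees f q) t + coeff G t)
            (≡.sym (gens-extend E f plug-E gs)) (by-image t (image? t))
    where
    by-image : ∀ t → Dec (∃ λ s → f s ≡ t) →
               coeff (mapTrees f p) t ≈ coeff (mapTrees f q) t + coeff (mapTrees f (gens gs)) t
    by-image _ (yes (s , ≡.refl)) = begin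
      coeff (mapTrees f p) (f s)                                  ≈⟨ coeff-mapTrees-image f-inj p s ⟩
      coeff p s                                                   ≈⟨ p≈q s ⟩
      coeff q s + coeff (gens gs) s
        ≈⟨ +-cong (coeff-mapTrees-image f-inj q s) (coeff-mapTrees-image f-inj (gens gs) s) ⟨
      coeff (mapTrees f q) (f s) + coeff (mapTrees f (gens gs)) (f s) ∎
    by-image t (no t∉f) = begin
      coeff (mapTrees f p) t                                      ≈⟨ coeff-mapTrees-outside t∉f′ p ⟩
      0#                                                          ≈⟨ +-identityʳ 0# ⟨
      0# + 0#
        ≈⟨ +-cong (coeff-mapTrees-outside t∉f′ q) (coeff-mapTrees-outside t∉f′ (gens gs)) ⟨
      coeff (mapTrees f q) t + coeff (mapTrees f (gens gs)) t     ∎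
      where
      t∉f′ : ∀ s → f s ≢ t
      t∉f′ s fs≡t = t∉f (s , fs≡t)

  ≈ᴵ-lOp : ∀ o r {p q} → p ≈ᴵ q → lOp o p r ≈ᴵ lOp o q r
  ≈ᴵ-lOp o r = ≈ᴵ-context (λ C → inL o C r) (λ v → node o v r) (λ _ _ → ≡.refl) node-injective image?
    where
    node-injective : Injective _≡_ _≡_ (λ v → node o v r)
    node-injective ≡.refl = ≡.refl
    image? : ∀ t → Dec (∃ λ s → node o s r ≡ t)
    image? x = no λ ()
    image? (node o′ s r′) with o ≟Op o′ | r ≟T r′
    ... | yes ≡.refl | yes ≡.refl = yes (s , ≡.refl)
    ... | no  o≢o′   | _          = no λ { (_ , ≡.refl) → o≢o′ ≡.refl }
    ... | yes _      | no  r≢r′   = no λ { (_ , ≡.refl) → r≢r′ ≡.refl }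

  ≈ᴵ-rOp : ∀ o l {p q} → p ≈ᴵ q → rOp o l p ≈ᴵ rOp o l q
  ≈ᴵ-rOp o l = ≈ᴵ-context (λ C → inR o l C) (λ v → node o l v) (λ _ _ → ≡.refl) node-injective image?
    where
    node-injective : Injective _≡_ _≡_ (λ v → node o l v)
    node-injective ≡.refl = ≡.refl
    image? : ∀ t → Dec (∃ λ s → node o l s ≡ t)
    image? x = no λ ()
    image? (node o′ l′ s) with o ≟Op o′ | l ≟T l′
    ... | yes ≡.refl | yes ≡.refl = yes (s , ≡.refl)
    ... | no  o≢o′   | _          = no λ { (_ , ≡.refl) → o≢o′ ≡.refl }
    ... | yes _      | no  l≢l′   = no λ { (_ , ≡.refl) → l≢l′ ≡.refl }

  leftBracketings : List (Op × Op) → Tree → Tree → Tree → LC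
  leftBracketings os s t u = map (λ { (o , o′) → (1# , node o′ (node o s t) u) }) os

  rightBracketings : List (Op × Op) → Tree → Tree → Tree → LC
  rightBracketings os s t u = map (λ { (o , o′) → (1# , node o s (node o′ t u)) }) os

  relator-bracketings : ∀ R s t u →
    relator R s t u ≡ leftBracketings (lhsOps R) s t u ++ neg (rightBracketings (rhsOps R) s t u)
  relator-bracketings assoc∘ s t u = ≡.refl
  relator-bracketings r◁◁    s t u = ≡.refl
  relator-bracketings r▷◁    s t u = ≡.refl
  relator-bracketings r⊙▷    s t u = ≡.refl
  relator-bracketings r▷∘    s t u = ≡.refl
  relator-bracketings r◁∘    s t u = ≡.refl
  relator-bracketings r∘◁    s t u = ≡.refl

  relator≈ᴵ[] : ∀ R s t u → relator R s t u ≈ᴵ []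
  relator≈ᴵ[] R s t u = mod ((1# , hole , R , s , t , u) ∷ []) λ v → begin
    coeff (relator R s t u) v                              ≈⟨ unit v (relator R s t u) ⟨
    coeff (genLC (1# , hole , R , s , t , u)) v            ≈⟨ +-identityʳ _ ⟨
    coeff (genLC (1# , hole , R , s , t , u)) v + 0#       ≈⟨ coeff-++ (genLC (1# , hole , R , s , t , u)) [] v ⟨
    coeff (gens ((1# , hole , R , s , t , u) ∷ [])) v      ≈⟨ +-identityˡ _ ⟨
    0# + coeff (gens ((1# , hole , R , s , t , u) ∷ [])) v ∎
    where
    unit : ∀ v (L : LC) → coeff (map (λ { (b , w) → (1# * b , w) }) L) v ≈ coeff L v
    unit v []            = refl
    unit v ((b , w) ∷ L) with w ≟T v
    ... | yes _ = +-cong (*-identityˡ b) (unit v L)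
    ... | no  _ = unit v L

  difference≈ᴵ[] : ∀ p q → p ++ neg q ≈ᴵ [] → p ≈ᴵ q
  difference≈ᴵ[] p q p-q≈0 =
    ≈ᴵ-trans (coeff⇒≈ᴵ p≐p-q+q)
             (≈ᴵ-trans (≡⇒≈ᴵ (≡.sym (++-assoc p (neg q) q))) (≈ᴵ-++ p-q≈0 (≈ᴵ-refl {q})))
    where
    p≐p-q+q : ∀ t → coeff p t ≈ coeff (p ++ (neg q ++ q)) t
    p≐p-q+q t = sym (begin
      coeff (p ++ (neg q ++ q)) t                 ≈⟨ coeff-++ p _ t ⟩
      coeff p t + coeff (neg q ++ q) t            ≈⟨ +-congˡ (coeff-++ (neg q) q t) ⟩
      coeff p t + (coeff (neg q) t + coeff q t)   ≈⟨ +-congˡ (+-congʳ (coeff-neg q t)) ⟩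
      coeff p t + (- coeff q t + coeff q t)       ≈⟨ +-congˡ (-‿inverseˡ _) ⟩
      coeff p t + 0#                              ≈⟨ +-identityʳ _ ⟩
      coeff p t                                   ∎)

  relation : ∀ R s t u → leftBracketings (lhsOps R) s t u ≈ᴵ rightBracketings (rhsOps R) s t u
  relation R s t u = difference≈ᴵ[] _ _ (≡.subst (_≈ᴵ []) (relator-bracketings R s t u) (relator≈ᴵ[] R s t u))

fuse : ∀ {a b c d} {A : Set a} {B : Set b} {C : Set c} {D : Set d}
         {f : A → B} {g : B → C} {f′ : A → D} {g′ : D → C} →
       (∀ z → g (f z) ≡ g′ (f′ z)) → ∀ xs → map g (map f xs) ≡ map g′ (map f′ xs)
fuse gf≗g′f′ xs = ≡.trans (≡.sym (map-∘ xs)) (≡.trans (map-cong gf≗g′f′ xs) (map-∘ xs))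

module Spanning {c ℓ : Level} (K : Field c ℓ) where
  open Field K
  open FreeTri K
  open Ideal K

  single : Tree → LC
  single t = (1# , t) ∷ []

  nfs : List Nf → LC
  nfs = map (λ e → (1# , ⟦ e ⟧))

  chains : List Chain → LC
  chains = map (λ k → (1# , ⟦ k ⟧ᶜ))

  ++ᶜ-correct : ∀ k l → single (node ∘ ⟦ k ⟧ᶜ ⟦ l ⟧ᶜ) ≈ᴵ single ⟦ k ++ᶜ l ⟧ᶜ
  ++ᶜ-correct (atom a) l = ≈ᴵ-refl
  ++ᶜ-correct (a ∘ₙ k) l =
    ≈ᴵ-trans (relation assoc∘ ⟦ a ⟧ᵃ ⟦ k ⟧ᶜ ⟦ l ⟧ᶜ) (≈ᴵ-rOp ∘ ⟦ a ⟧ᵃ (++ᶜ-correct k l))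

  mutual
    mul⊙-correct : ∀ e f → ⊙ ⟦ e ⟧ ⟦ f ⟧ ≈ᴵ nfs (mul⊙ e f)
    mul⊙-correct e f =
      ≈ᴵ-trans (≈ᴵ-++ (mul◁-correct e f) (≈ᴵ-++ (mul∘-correct e f) (mul▷-correct e f)))
               (≡⇒≈ᴵ (≡.sym (≡.trans (map-++ _ (mul◁ e f) _) (≡.cong (nfs (mul◁ e f) ++_) (map-++ _ (mul∘ e f) _)))))

    mul◁-correct : ∀ e f → single (node ◁ ⟦ e ⟧ ⟦ f ⟧) ≈ᴵ nfs (mul◁ e f)
    mul◁-correct (chain k) f = ≈ᴵ-trans (chain◁-correct k f) (≡⇒≈ᴵ (map-∘ (chain◁ k f)))
    mul◁-correct (e ▷ₙ k) f =
      ≈ᴵ-trans (relation r▷◁ ⟦ e ⟧ ⟦ k ⟧ᶜ ⟦ f ⟧)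
               (≈ᴵ-trans (≈ᴵ-rOp ▷ ⟦ e ⟧ (chain◁-correct k f)) (≡⇒≈ᴵ (fuse (λ _ → ≡.refl) (chain◁ k f))))

    chain◁-correct : ∀ k f → single (node ◁ ⟦ k ⟧ᶜ ⟦ f ⟧) ≈ᴵ chains (chain◁ k f)
    chain◁-correct (atom gen) f      = ≈ᴵ-refl
    chain◁-correct (atom (gen◁ e)) f =
      ≈ᴵ-trans (relation r◁◁ x ⟦ e ⟧ ⟦ f ⟧)
               (≈ᴵ-trans (≈ᴵ-rOp ◁ x (mul⊙-correct e f)) (≡⇒≈ᴵ (fuse (λ _ → ≡.refl) (mul⊙ e f))))
    chain◁-correct (a ∘ₙ k) f =
      ≈ᴵ-trans (relation r∘◁ ⟦ a ⟧ᵃ ⟦ k ⟧ᶜ ⟦ f ⟧)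
               (≈ᴵ-trans (≈ᴵ-rOp ∘ ⟦ a ⟧ᵃ (chain◁-correct k f)) (≡⇒≈ᴵ (fuse (λ _ → ≡.refl) (chain◁ k f))))

    mul∘-correct : ∀ e f → single (node ∘ ⟦ e ⟧ ⟦ f ⟧) ≈ᴵ nfs (mul∘ e f)
    mul∘-correct (chain k) f = ≈ᴵ-trans (chain∘-correct k f) (≡⇒≈ᴵ (map-∘ (chain∘ k f)))
    mul∘-correct (e ▷ₙ k) f =
      ≈ᴵ-trans (relation r▷∘ ⟦ e ⟧ ⟦ k ⟧ᶜ ⟦ f ⟧)
               (≈ᴵ-trans (≈ᴵ-rOp ▷ ⟦ e ⟧ (chain∘-correct k f)) (≡⇒≈ᴵ (fuse (λ _ → ≡.refl) (chain∘ k f))))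

    chain∘-correct : ∀ k f → single (node ∘ ⟦ k ⟧ᶜ ⟦ f ⟧) ≈ᴵ chains (chain∘ k f)
    chain∘-correct k (chain l) = ++ᶜ-correct k l
    chain∘-correct k (f ▷ₙ l)  =
      ≈ᴵ-trans (≈ᴵ-sym (relation r◁∘ ⟦ k ⟧ᶜ ⟦ f ⟧ ⟦ l ⟧ᶜ))
               (≈ᴵ-trans (≈ᴵ-lOp ∘ ⟦ l ⟧ᶜ (chain◁-correct k f)) (append (chain◁ k f)))
      where
      append : ∀ ks → lOp ∘ (chains ks) ⟦ l ⟧ᶜ ≈ᴵ chains (map (_++ᶜ l) ks)
      append []       = ≈ᴵ-refl
      append (k ∷ ks) = ≈ᴵ-++ (++ᶜ-correct k l) (append ks)

    mul▷-correct : ∀ e f → single (node ▷ ⟦ e ⟧ ⟦ f ⟧) ≈ᴵ nfs (mul▷ e f)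
    mul▷-correct e (chain l) = ≈ᴵ-refl
    mul▷-correct e (f ▷ₙ l)  =
      ≈ᴵ-trans (≈ᴵ-sym (relation r⊙▷ ⟦ e ⟧ ⟦ f ⟧ ⟦ l ⟧ᶜ))
               (≈ᴵ-trans (≈ᴵ-lOp ▷ ⟦ l ⟧ᶜ (mul⊙-correct e f)) (≡⇒≈ᴵ (fuse (λ _ → ≡.refl) (mul⊙ e f))))

  mulNf-correct : ∀ o e f → single (node o ⟦ e ⟧ ⟦ f ⟧) ≈ᴵ nfs (mulNf o e f)
  mulNf-correct ◁ = mul◁-correct
  mulNf-correct ∘ = mul∘-correct
  mulNf-correct ▷ = mul▷-correct

  NfLC : Set c
  NfLC = List (Carrier × Nf)

  toLC : NfLC → LC
  toLC = map (map₂ ⟦_⟧)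

  scaleNf : Carrier → NfLC → NfLC
  scaleNf a = map (λ { (b , e) → (a * b , e) })

  ones : List Nf → NfLC
  ones = map (1# ,_)

  mulNfLCʳ : Op → Nf → NfLC → NfLC
  mulNfLCʳ o e = concatMap (λ { (b , f) → scaleNf b (ones (mulNf o e f)) })

  mulNfLC : Op → NfLC → NfLC → NfLC
  mulNfLC o P Q = concatMap (λ { (a , e) → scaleNf a (mulNfLCʳ o e Q) }) P

  normalise : Tree → NfLC
  normalise x            = (1# , chain (atom gen)) ∷ []
  normalise (node o s t) = mulNfLC o (normalise s) (normalise t)

  toLC-++ : ∀ P Q → toLC (P ++ Q) ≡ toLC P ++ toLC Q
  toLC-++ = map-++ (map₂ ⟦_⟧)

  toLC-scaleNf : ∀ a P → toLC (scaleNf a P) ≡ scaleLC a (toLC P)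
  toLC-scaleNf a = fuse (λ _ → ≡.refl)

  toLC-ones : ∀ es → toLC (ones es) ≡ nfs es
  toLC-ones es = ≡.sym (map-∘ es)

  ≈ᴵ-singleton : ∀ {a b} s → a ≈ b → (a , s) ∷ [] ≈ᴵ (b , s) ∷ []
  ≈ᴵ-singleton {a} {b} s a≈b = coeff⇒≈ᴵ same
    where
    same : ∀ t → coeff ((a , s) ∷ []) t ≈ coeff ((b , s) ∷ []) t
    same t with s ≟T t
    ... | yes _ = +-congʳ a≈b
    ... | no  _ = refl

  ≈ᴵ-term : ∀ a {s} {P : NfLC} → single s ≈ᴵ toLC P → (a , s) ∷ [] ≈ᴵ toLC (scaleNf a P)
  ≈ᴵ-term a {s} {P} s≈P =
    ≈ᴵ-trans (≈ᴵ-singleton s (sym (*-identityʳ a)))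
             (≈ᴵ-trans (≈ᴵ-scale a s≈P) (≡⇒≈ᴵ (≡.sym (toLC-scaleNf a P))))

  ≈ᴵ-termwise : ∀ {p q : LC} {P Q : NfLC} → p ≈ᴵ toLC P → q ≈ᴵ toLC Q → p ++ q ≈ᴵ toLC (P ++ Q)
  ≈ᴵ-termwise {P = P} {Q} p≈P q≈Q = ≈ᴵ-trans (≈ᴵ-++ p≈P q≈Q) (≡⇒≈ᴵ (≡.sym (toLC-++ P Q)))

  rOp-normalise : ∀ o e Q → rOp o ⟦ e ⟧ (toLC Q) ≈ᴵ toLC (mulNfLCʳ o e Q)
  rOp-normalise o e []            = ≈ᴵ-refl
  rOp-normalise o e ((b , f) ∷ Q) =
    ≈ᴵ-termwise (≈ᴵ-term b (≈ᴵ-trans (mulNf-correct o e f) (≡⇒≈ᴵ (≡.sym (toLC-ones (mulNf o e f))))))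
                (rOp-normalise o e Q)

  lOp-normalise : ∀ o {t} Q → single t ≈ᴵ toLC Q → ∀ P → lOp o (toLC P) t ≈ᴵ toLC (mulNfLC o P Q)
  lOp-normalise o Q t≈Q []            = ≈ᴵ-refl
  lOp-normalise o Q t≈Q ((a , e) ∷ P) =
    ≈ᴵ-termwise (≈ᴵ-term a (≈ᴵ-trans (≈ᴵ-rOp o ⟦ e ⟧ t≈Q) (rOp-normalise o e Q))) (lOp-normalise o Q t≈Q P)

  normalise-correct : ∀ t → single t ≈ᴵ toLC (normalise t)
  normalise-correct x            = ≈ᴵ-refl
  normalise-correct (node o s t) =
    ≈ᴵ-trans (≈ᴵ-lOp o t (normalise-correct s)) (lOp-normalise o (normalise t) (normalise-correct t) (normalise s))

  normaliseLC : LC → NfLC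
  normaliseLC []            = []
  normaliseLC ((a , t) ∷ p) = scaleNf a (normalise t) ++ normaliseLC p

  normaliseLC-correct : ∀ p → p ≈ᴵ toLC (normaliseLC p)
  normaliseLC-correct []            = ≈ᴵ-refl
  normaliseLC-correct ((a , t) ∷ p) = ≈ᴵ-termwise (≈ᴵ-term a (normalise-correct t)) (normaliseLC-correct p)

module Sums {c ℓ : Level} (K : Field c ℓ) where
  open Field K
  open Series K
  open import Algebra.Properties.CommutativeSemigroup +-commutativeSemigroup using (interchange)
  open import Relation.Binary.Reasoning.Setoid setoid

  onlyIf : Bool → Carrier → Carrier
  onlyIf true  a = a
  onlyIf false a = 0#

  onlyIf-cong : ∀ b {z z′} → z ≈ z′ → onlyIf b z ≈ onlyIf b z′
  onlyIf-cong true  z≈z′ = z≈z′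
  onlyIf-cong false z≈z′ = refl

  onlyIf-*ʳ : ∀ b z z′ → onlyIf b z * z′ ≈ onlyIf b (z * z′)
  onlyIf-*ʳ true  z z′ = refl
  onlyIf-*ʳ false z z′ = zeroˡ z′

  onlyIf-*ˡ : ∀ b z z′ → z * onlyIf b z′ ≈ onlyIf b (z * z′)
  onlyIf-*ˡ true  z z′ = refl
  onlyIf-*ˡ false z z′ = zeroʳ z

  onlyIf-∧ : ∀ b b′ z → onlyIf b (onlyIf b′ z) ≡ onlyIf (b ∧ b′) z
  onlyIf-∧ true  b′ z = ≡.refl
  onlyIf-∧ false b′ z = ≡.refl

  onlyIf-0# : ∀ b → onlyIf b 0# ≈ 0#
  onlyIf-0# true  = refl
  onlyIf-0# false = refl

  sel-onlyIf : ∀ o m n z → sel o m n z ≡ onlyIf (holds o (compare m n)) z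
  sel-onlyIf ◁ m n z with <-cmp m n
  ... | tri< _ _ _ = ≡.refl
  ... | tri≈ _ _ _ = ≡.refl
  ... | tri> _ _ _ = ≡.refl
  sel-onlyIf ∘ m n z with <-cmp m n
  ... | tri< _ _ _ = ≡.refl
  ... | tri≈ _ _ _ = ≡.refl
  ... | tri> _ _ _ = ≡.refl
  sel-onlyIf ▷ m n z with <-cmp m n
  ... | tri< _ _ _ = ≡.refl
  ... | tri≈ _ _ _ = ≡.refl
  ... | tri> _ _ _ = ≡.refl

  sumOver : ∀ {A : Set} → List A → (A → Carrier) → Carrier
  sumOver L F = sumK (map F L)

  sumOver-cong : ∀ {A : Set} (L : List A) {F G : A → Carrier} → (∀ a → F a ≈ G a) → sumOver L F ≈ sumOver L G
  sumOver-cong []      F≈G = refl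
  sumOver-cong (a ∷ L) F≈G = +-cong (F≈G a) (sumOver-cong L F≈G)

  sumOver-zero : ∀ {A : Set} (L : List A) {F : A → Carrier} → (∀ a → F a ≈ 0#) → sumOver L F ≈ 0#
  sumOver-zero []      F≈0 = refl
  sumOver-zero (a ∷ L) F≈0 = trans (+-cong (F≈0 a) (sumOver-zero L F≈0)) (+-identityˡ 0#)

  sumOver-+ : ∀ {A : Set} (L : List A) (F G : A → Carrier) →
              sumOver L (λ a → F a + G a) ≈ sumOver L F + sumOver L G
  sumOver-+ []      F G = sym (+-identityˡ 0#)
  sumOver-+ (a ∷ L) F G = trans (+-congˡ (sumOver-+ L F G)) (interchange _ _ _ _)

  sumOver-*ˡ : ∀ {A : Set} (L : List A) (F : A → Carrier) y → y * sumOver L F ≈ sumOver L (λ a → y * F a)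
  sumOver-*ˡ []      F y = zeroʳ y
  sumOver-*ˡ (a ∷ L) F y = trans (distribˡ y (F a) _) (+-congˡ (sumOver-*ˡ L F y))

  sumOver-*ʳ : ∀ {A : Set} (L : List A) (F : A → Carrier) y → sumOver L F * y ≈ sumOver L (λ a → F a * y)
  sumOver-*ʳ []      F y = zeroˡ y
  sumOver-*ʳ (a ∷ L) F y = trans (distribʳ y (F a) _) (+-congˡ (sumOver-*ʳ L F y))

  sumOver-onlyIf : ∀ {A : Set} (L : List A) (F : A → Carrier) b → onlyIf b (sumOver L F) ≈ sumOver L (λ a → onlyIf b (F a))
  sumOver-onlyIf L F true  = refl
  sumOver-onlyIf L F false = sym (sumOver-zero L (λ _ → refl))

  sumOver-swap : ∀ {A B : Set} (L : List A) (M : List B) (F : A → B → Carrier) →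
                 sumOver L (λ a → sumOver M (F a)) ≈ sumOver M (λ b → sumOver L (λ a → F a b))
  sumOver-swap []      M F = sym (sumOver-zero M (λ _ → refl))
  sumOver-swap (a ∷ L) M F = begin
    sumOver M (F a) + sumOver L (λ a′ → sumOver M (F a′))    ≈⟨ +-congˡ (sumOver-swap L M F) ⟩
    sumOver M (F a) + sumOver M (λ b → sumOver L (λ a′ → F a′ b)) ≈⟨ sumOver-+ M (F a) _ ⟨
    sumOver M (λ b → F a b + sumOver L (λ a′ → F a′ b))      ∎

  sumSplits : ℕ → List ℕ → (Word⁺ → Word⁺ → Carrier) → Carrier
  sumSplits a as F = sumOver (splits a as) (uncurry F)

  sumSplits-cong : ∀ a as {F G : Word⁺ → Word⁺ → Carrier} → (∀ U V → F U V ≈ G U V) →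
                   sumSplits a as F ≈ sumSplits a as G
  sumSplits-cong a as F≈G = sumOver-cong (splits a as) (λ { (U , V) → F≈G U V })

  sumSplits-∷ : ∀ a b bs F → sumSplits a (b ∷ bs) F ≡ F (a , []) (b , bs) + sumSplits b bs (λ U V → F (a , toWord U) V)
  sumSplits-∷ a b bs F = ≡.cong (λ z → F (a , []) (b , bs) + sumK z) (≡.sym (map-∘ (splits b bs)))

  sumSplits-max : ∀ a as (F : ℕ → Word⁺ → Word⁺ → Carrier) →
                  sumSplits a as (F (maxW a as)) ≈ sumSplits a as (λ U V → F (max⁺ U ⊔ max⁺ V) U V)
  sumSplits-max a []       F = refl
  sumSplits-max a (b ∷ bs) F = begin
    sumSplits a (b ∷ bs) (F (maxW a (b ∷ bs)))
      ≡⟨ sumSplits-∷ a b bs _ ⟩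
    F (a ⊔ maxW b bs) (a , []) (b , bs) + sumSplits b bs (λ U V → F (a ⊔ maxW b bs) (a , toWord U) V)
      ≈⟨ +-congˡ (sumSplits-max b bs (λ m U V → F (a ⊔ m) (a , toWord U) V)) ⟩
    F (a ⊔ maxW b bs) (a , []) (b , bs) + sumSplits b bs (λ U V → F (a ⊔ (max⁺ U ⊔ max⁺ V)) (a , toWord U) V)
      ≈⟨ +-congˡ (sumSplits-cong b bs (λ U V → reflexive (≡.cong (λ m → F m (a , toWord U) V)
                                                               (≡.sym (⊔-assoc a (max⁺ U) (max⁺ V)))))) ⟩
    F (a ⊔ maxW b bs) (a , []) (b , bs) + sumSplits b bs (λ U V → F ((a ⊔ max⁺ U) ⊔ max⁺ V) (a , toWord U) V)
      ≡⟨ sumSplits-∷ a b bs _ ⟨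
    sumSplits a (b ∷ bs) (λ U V → F (max⁺ U ⊔ max⁺ V) U V) ∎

  sumSplits-cong-split : ∀ a as {F G : Word⁺ → Word⁺ → Carrier} →
    (∀ U V → proj₁ U ≡ a → maxW a as ≡ max⁺ U ⊔ max⁺ V → F U V ≈ G U V) → sumSplits a as F ≈ sumSplits a as G
  sumSplits-cong-split a []       F≈G = refl
  sumSplits-cong-split a (b ∷ bs) {F} {G} F≈G = begin
    sumSplits a (b ∷ bs) F                                        ≡⟨ sumSplits-∷ a b bs F ⟩
    F (a , []) (b , bs) + sumSplits b bs (λ U V → F (a , toWord U) V)
      ≈⟨ +-cong (F≈G (a , []) (b , bs) ≡.refl ≡.refl) (sumSplits-cong-split b bs (λ U V _ max≡ →
                 F≈G (a , toWord U) V ≡.refl (≡.trans (≡.cong (a ⊔_) max≡) (≡.sym (⊔-assoc a (max⁺ U) (max⁺ V)))))) ⟩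
    G (a , []) (b , bs) + sumSplits b bs (λ U V → G (a , toWord U) V) ≡⟨ sumSplits-∷ a b bs G ⟨
    sumSplits a (b ∷ bs) G                                        ∎

  sumSplits³ˡ sumSplits³ʳ : ℕ → List ℕ → (Word⁺ → Word⁺ → Word⁺ → Carrier) → Carrier
  sumSplits³ˡ a as F = sumSplits a as (λ U V → sumSplits (proj₁ U) (proj₂ U) (λ U₁ U₂ → F U₁ U₂ V))
  sumSplits³ʳ a as F = sumSplits a as (λ U₁ W → sumSplits (proj₁ W) (proj₂ W) (λ U₂ V → F U₁ U₂ V))

  sumSplits³-assoc : ∀ a as F → sumSplits³ˡ a as F ≈ sumSplits³ʳ a as F
  sumSplits³-assoc a []       F = refl
  sumSplits³-assoc a (b ∷ bs) F = begin
    sumSplits³ˡ a (b ∷ bs) F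
      ≡⟨ sumSplits-∷ a b bs _ ⟩
    0# + sumSplits b bs (λ U V → sumSplits a (toWord U) (λ U₁ U₂ → F U₁ U₂ V))
      ≈⟨ +-identityˡ _ ⟩
    sumSplits b bs (λ U V → sumSplits a (toWord U) (λ U₁ U₂ → F U₁ U₂ V))
      ≈⟨ sumSplits-cong b bs (λ U V → reflexive (sumSplits-∷ a (proj₁ U) (proj₂ U) _)) ⟩
    sumSplits b bs (λ U V → F (a , []) U V + sumSplits (proj₁ U) (proj₂ U) (λ U₁ U₂ → F (a , toWord U₁) U₂ V))
      ≈⟨ sumOver-+ (splits b bs) _ _ ⟩
    sumSplits b bs (F (a , [])) + sumSplits³ˡ b bs (λ U₁ U₂ V → F (a , toWord U₁) U₂ V)
      ≈⟨ +-congˡ (sumSplits³-assoc b bs _) ⟩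
    sumSplits b bs (F (a , [])) + sumSplits³ʳ b bs (λ U₁ U₂ V → F (a , toWord U₁) U₂ V)
      ≡⟨ sumSplits-∷ a b bs _ ⟨
    sumSplits³ʳ a (b ∷ bs) F ∎

module BracketingIdentities {c ℓ : Level} (K : Field c ℓ) where
  open Field K
  open Series K
  open Sums K
  open import Relation.Binary.Reasoning.Setoid setoid

  leftBracket rightBracket : Op × Op → Ser → Ser → Ser → Ser
  leftBracket  (o , o′) f g h = prod o′ (prod o f g) h
  rightBracket (o , o′) f g h = prod o f (prod o′ g h)

  term : Ser → Ser → Ser → Word⁺ → Word⁺ → Word⁺ → Carrier
  term f g h U₁ U₂ V = f (toWord U₁) * (g (toWord U₂) * h (toWord V))

  compare⁺ : Word⁺ → Word⁺ → Word⁺ → Cmp³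
  compare⁺ U₁ U₂ V = compare³ (max⁺ U₁) (max⁺ U₂) (max⁺ V)

  onlyIf-sel-*ʳ : ∀ b o m n y z → onlyIf b (sel o m n y * z) ≈ onlyIf (b ∧ holds o (compare m n)) (y * z)
  onlyIf-sel-*ʳ b o m n y z = begin
    onlyIf b (sel o m n y * z)                      ≡⟨ ≡.cong (λ s → onlyIf b (s * z)) (sel-onlyIf o m n y) ⟩
    onlyIf b (onlyIf (holds o (compare m n)) y * z) ≈⟨ onlyIf-cong b (onlyIf-*ʳ (holds o (compare m n)) y z) ⟩
    onlyIf b (onlyIf (holds o (compare m n)) (y * z)) ≡⟨ onlyIf-∧ b _ (y * z) ⟩
    onlyIf (b ∧ holds o (compare m n)) (y * z)      ∎

  onlyIf-sel-*ˡ : ∀ b o m n y z → onlyIf b (y * sel o m n z) ≈ onlyIf (b ∧ holds o (compare m n)) (y * z)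
  onlyIf-sel-*ˡ b o m n y z = begin
    onlyIf b (y * sel o m n z)                      ≡⟨ ≡.cong (λ s → onlyIf b (y * s)) (sel-onlyIf o m n z) ⟩
    onlyIf b (y * onlyIf (holds o (compare m n)) z) ≈⟨ onlyIf-cong b (onlyIf-*ˡ (holds o (compare m n)) y z) ⟩
    onlyIf b (onlyIf (holds o (compare m n)) (y * z)) ≡⟨ onlyIf-∧ b _ (y * z) ⟩
    onlyIf (b ∧ holds o (compare m n)) (y * z)      ∎

  leftBracket-expand : ∀ p f g h a as →
    leftBracket p f g h (a ∷ as) ≈ sumSplits³ˡ a as (λ U₁ U₂ V → onlyIf (leftHolds p (compare⁺ U₁ U₂ V)) (term f g h U₁ U₂ V))
  leftBracket-expand (o , o′) f g h a as = sumSplits-cong a as expand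
    where
    expand : ∀ U V → sel o′ (max⁺ U) (max⁺ V) (prod o f g (toWord U) * h (toWord V)) ≈
                     sumSplits (proj₁ U) (proj₂ U) (λ U₁ U₂ → onlyIf (leftHolds (o , o′) (compare⁺ U₁ U₂ V)) (term f g h U₁ U₂ V))
    expand (u , us) V = begin
      sel o′ (maxW u us) (max⁺ V) (prod o f g (u ∷ us) * h (toWord V))
        ≡⟨ sel-onlyIf o′ _ _ _ ⟩
      onlyIf outer (sumSplits u us (λ U₁ U₂ → sel o (max⁺ U₁) (max⁺ U₂) (f (toWord U₁) * g (toWord U₂))) * h (toWord V))
        ≈⟨ onlyIf-cong outer (sumOver-*ʳ (splits u us) _ _) ⟩
      onlyIf outer (sumSplits u us (λ U₁ U₂ → sel o (max⁺ U₁) (max⁺ U₂) (f (toWord U₁) * g (toWord U₂)) * h (toWord V)))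
        ≈⟨ sumOver-onlyIf (splits u us) _ outer ⟩
      sumSplits u us (λ U₁ U₂ → onlyIf outer (sel o (max⁺ U₁) (max⁺ U₂) (f (toWord U₁) * g (toWord U₂)) * h (toWord V)))
        ≈⟨ sumSplits-cong u us (λ U₁ U₂ → trans (onlyIf-sel-*ʳ outer o _ _ _ _)
                                                      (onlyIf-cong (joined (maxW u us) U₁ U₂) (*-assoc _ _ (h (toWord V)))))  ⟩
      sumSplits u us (λ U₁ U₂ → onlyIf (joined (maxW u us) U₁ U₂) (term f g h U₁ U₂ V))
        ≈⟨ sumSplits-max u us (λ m U₁ U₂ → onlyIf (joined m U₁ U₂) (term f g h U₁ U₂ V)) ⟩
      sumSplits u us (λ U₁ U₂ → onlyIf (joined (max⁺ U₁ ⊔ max⁺ U₂) U₁ U₂) (term f g h U₁ U₂ V))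
        ≈⟨ sumSplits-cong u us (λ U₁ U₂ → reflexive (≡.cong (λ c → onlyIf (holds o′ c ∧ holds o (compare (max⁺ U₁) (max⁺ U₂)))
                                                                          (term f g h U₁ U₂ V))
                                                            (compare-⊔ˡ (max⁺ U₁) (max⁺ U₂) (max⁺ V)))) ⟩
      sumSplits u us (λ U₁ U₂ → onlyIf (leftHolds (o , o′) (compare⁺ U₁ U₂ V)) (term f g h U₁ U₂ V)) ∎
      where
      outer = holds o′ (compare (maxW u us) (max⁺ V))
      joined : ℕ → Word⁺ → Word⁺ → Bool
      joined m U₁ U₂ = holds o′ (compare m (max⁺ V)) ∧ holds o (compare (max⁺ U₁) (max⁺ U₂))

  rightBracket-expand : ∀ p f g h a as →
    rightBracket p f g h (a ∷ as) ≈ sumSplits³ʳ a as (λ U₁ U₂ V → onlyIf (rightHolds p (compare⁺ U₁ U₂ V)) (term f g h U₁ U₂ V))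
  rightBracket-expand (o , o′) f g h a as = sumSplits-cong a as expand
    where
    expand : ∀ U₁ W → sel o (max⁺ U₁) (max⁺ W) (f (toWord U₁) * prod o′ g h (toWord W)) ≈
                      sumSplits (proj₁ W) (proj₂ W) (λ U₂ V → onlyIf (rightHolds (o , o′) (compare⁺ U₁ U₂ V)) (term f g h U₁ U₂ V))
    expand U₁ (v , vs) = begin
      sel o (max⁺ U₁) (maxW v vs) (f (toWord U₁) * prod o′ g h (v ∷ vs))
        ≡⟨ sel-onlyIf o _ _ _ ⟩
      onlyIf outer (f (toWord U₁) * sumSplits v vs (λ U₂ V → sel o′ (max⁺ U₂) (max⁺ V) (g (toWord U₂) * h (toWord V))))
        ≈⟨ onlyIf-cong outer (sumOver-*ˡ (splits v vs) _ _) ⟩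
      onlyIf outer (sumSplits v vs (λ U₂ V → f (toWord U₁) * sel o′ (max⁺ U₂) (max⁺ V) (g (toWord U₂) * h (toWord V))))
        ≈⟨ sumOver-onlyIf (splits v vs) _ outer ⟩
      sumSplits v vs (λ U₂ V → onlyIf outer (f (toWord U₁) * sel o′ (max⁺ U₂) (max⁺ V) (g (toWord U₂) * h (toWord V))))
        ≈⟨ sumSplits-cong v vs (λ U₂ V → onlyIf-sel-*ˡ outer o′ _ _ _ _) ⟩
      sumSplits v vs (λ U₂ V → onlyIf (joined (maxW v vs) U₂ V) (term f g h U₁ U₂ V))
        ≈⟨ sumSplits-max v vs (λ m U₂ V → onlyIf (joined m U₂ V) (term f g h U₁ U₂ V)) ⟩
      sumSplits v vs (λ U₂ V → onlyIf (joined (max⁺ U₂ ⊔ max⁺ V) U₂ V) (term f g h U₁ U₂ V))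
        ≈⟨ sumSplits-cong v vs (λ U₂ V → reflexive (≡.cong (λ c → onlyIf (holds o c ∧ holds o′ (compare (max⁺ U₂) (max⁺ V)))
                                                                         (term f g h U₁ U₂ V))
                                                           (compare-⊔ʳ (max⁺ U₁) (max⁺ U₂) (max⁺ V)))) ⟩
      sumSplits v vs (λ U₂ V → onlyIf (rightHolds (o , o′) (compare⁺ U₁ U₂ V)) (term f g h U₁ U₂ V)) ∎
      where
      outer = holds o (compare (max⁺ U₁) (maxW v vs))
      joined : ℕ → Word⁺ → Word⁺ → Bool
      joined m U₂ V = holds o (compare (max⁺ U₁) m) ∧ holds o′ (compare (max⁺ U₂) (max⁺ V))

  sumOver-onlyIf-trues : ∀ {A : Set} (L : List A) (P : A → Bool) z →
                         sumOver L (λ a → onlyIf (P a) z) ≈ natK K (trues (map P L)) * z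
  sumOver-onlyIf-trues []      P z = sym (zeroˡ z)
  sumOver-onlyIf-trues (a ∷ L) P z with P a
  ... | true  = trans (+-cong (sym (*-identityˡ z)) (sumOver-onlyIf-trues L P z)) (sym (distribʳ z 1# _))
  ... | false = trans (+-identityˡ _) (sumOver-onlyIf-trues L P z)

  sumOver-sumSplits³ˡ : ∀ {A : Set} (L : List A) a as (F : A → Word⁺ → Word⁺ → Word⁺ → Carrier) →
    sumOver L (λ p → sumSplits³ˡ a as (F p)) ≈ sumSplits³ˡ a as (λ U₁ U₂ V → sumOver L (λ p → F p U₁ U₂ V))
  sumOver-sumSplits³ˡ L a as F =
    trans (sumOver-swap L (splits a as) _) (sumSplits-cong a as (λ U V → sumOver-swap L (splits (proj₁ U) (proj₂ U)) _))

  sumOver-sumSplits³ʳ : ∀ {A : Set} (L : List A) a as (F : A → Word⁺ → Word⁺ → Word⁺ → Carrier) →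
    sumOver L (λ p → sumSplits³ʳ a as (F p)) ≈ sumSplits³ʳ a as (λ U₁ U₂ V → sumOver L (λ p → F p U₁ U₂ V))
  sumOver-sumSplits³ʳ L a as F =
    trans (sumOver-swap L (splits a as) _) (sumSplits-cong a as (λ U₁ W → sumOver-swap L (splits (proj₁ W) (proj₂ W)) _))

  bracketings-agree : ∀ L R → BracketingsAgree L R → ∀ f g h w →
                      sumOver L (λ p → leftBracket p f g h w) ≈ sumOver R (λ p → rightBracket p f g h w)
  bracketings-agree L R agree f g h []       = trans (sumOver-zero L (λ _ → refl)) (sym (sumOver-zero R (λ _ → refl)))
  bracketings-agree L R agree f g h (a ∷ as) = begin
    sumOver L (λ p → leftBracket p f g h (a ∷ as))
      ≈⟨ sumOver-cong L (λ p → leftBracket-expand p f g h a as) ⟩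
    sumOver L (λ p → sumSplits³ˡ a as (λ U₁ U₂ V → onlyIf (leftHolds p (compare⁺ U₁ U₂ V)) (term f g h U₁ U₂ V)))
      ≈⟨ sumOver-sumSplits³ˡ L a as _ ⟩
    sumSplits³ˡ a as (λ U₁ U₂ V → sumOver L (λ p → onlyIf (leftHolds p (compare⁺ U₁ U₂ V)) (term f g h U₁ U₂ V)))
      ≈⟨ sumSplits³-assoc a as _ ⟩
    sumSplits³ʳ a as (λ U₁ U₂ V → sumOver L (λ p → onlyIf (leftHolds p (compare⁺ U₁ U₂ V)) (term f g h U₁ U₂ V)))
      ≈⟨ sumSplits-cong a as (λ U₁ W → sumSplits-cong (proj₁ W) (proj₂ W) (λ U₂ V → same-count U₁ U₂ V)) ⟩
    sumSplits³ʳ a as (λ U₁ U₂ V → sumOver R (λ p → onlyIf (rightHolds p (compare⁺ U₁ U₂ V)) (term f g h U₁ U₂ V)))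
      ≈⟨ sumOver-sumSplits³ʳ R a as _ ⟨
    sumOver R (λ p → sumSplits³ʳ a as (λ U₁ U₂ V → onlyIf (rightHolds p (compare⁺ U₁ U₂ V)) (term f g h U₁ U₂ V)))
      ≈⟨ sumOver-cong R (λ p → rightBracket-expand p f g h a as) ⟨
    sumOver R (λ p → rightBracket p f g h (a ∷ as)) ∎
    where
    same-count : ∀ U₁ U₂ V → sumOver L (λ p → onlyIf (leftHolds p (compare⁺ U₁ U₂ V)) (term f g h U₁ U₂ V))
                           ≈ sumOver R (λ p → onlyIf (rightHolds p (compare⁺ U₁ U₂ V)) (term f g h U₁ U₂ V))
    same-count U₁ U₂ V = begin
      sumOver L (λ p → onlyIf (leftHolds p t) X)           ≈⟨ sumOver-onlyIf-trues L (λ p → leftHolds p t) X ⟩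
      natK K (trues (map (λ p → leftHolds p t) L)) * X     ≡⟨ ≡.cong (λ n → natK K n * X) (All.lookup agree t-consistent) ⟩
      natK K (trues (map (λ p → rightHolds p t) R)) * X    ≈⟨ sumOver-onlyIf-trues R (λ p → rightHolds p t) X ⟨
      sumOver R (λ p → onlyIf (rightHolds p t) X)          ∎
      where
      t = compare⁺ U₁ U₂ V
      X = term f g h U₁ U₂ V
      t-consistent = compare³-consistent (max⁺ U₁) (max⁺ U₂) (max⁺ V)

module Products {c ℓ : Level} (K : Field c ℓ) where
  open Field K
  open Series K
  open Sums K

  sel-cong : ∀ o m n {y z} → y ≈ z → sel o m n y ≈ sel o m n z
  sel-cong o m n {y} {z} y≈z rewrite sel-onlyIf o m n y | sel-onlyIf o m n z = onlyIf-cong (holds o (compare m n)) y≈z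

  sel-linear : ∀ o m n b y z → sel o m n (b * y + z) ≈ b * sel o m n y + sel o m n z
  sel-linear o m n b y z
    rewrite sel-onlyIf o m n (b * y + z) | sel-onlyIf o m n y | sel-onlyIf o m n z with holds o (compare m n)
  ... | true  = refl
  ... | false = sym (trans (+-congʳ (zeroʳ b)) (+-identityˡ 0#))

  prod-cong : ∀ o {f f′ g g′ : Ser} → (∀ v → f v ≈ f′ v) → (∀ v → g v ≈ g′ v) →
              ∀ w → prod o f g w ≈ prod o f′ g′ w
  prod-cong o f≈f′ g≈g′ []       = refl
  prod-cong o f≈f′ g≈g′ (a ∷ as) =
    sumSplits-cong a as (λ U V → sel-cong o _ _ (*-cong (f≈f′ (toWord U)) (g≈g′ (toWord V))))

  sel-0# : ∀ o m n → sel o m n 0# ≈ 0#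
  sel-0# o m n rewrite sel-onlyIf o m n 0# = onlyIf-0# (holds o (compare m n))

  sumSplits-linear : ∀ a as b (F G : Word⁺ → Word⁺ → Carrier) →
                     sumSplits a as (λ U V → b * F U V + G U V) ≈ b * sumSplits a as F + sumSplits a as G
  sumSplits-linear a as b F G =
    trans (sumOver-+ (splits a as) _ _) (+-congʳ (sym (sumOver-*ˡ (splits a as) (uncurry F) b)))

  prod-linearˡ : ∀ o b (f f′ g : Ser) w → prod o (λ v → b * f v + f′ v) g w ≈ b * prod o f g w + prod o f′ g w
  prod-linearˡ o b f f′ g []       = sym (trans (+-congʳ (zeroʳ b)) (+-identityˡ 0#))
  prod-linearˡ o b f f′ g (a ∷ as) =
    trans (sumSplits-cong a as (λ U V → trans (sel-cong o _ _ (distribute (f (toWord U)) (f′ (toWord U)) (g (toWord V))))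
                                              (sel-linear o _ _ b _ _)))
          (sumSplits-linear a as b _ _)
    where
    distribute : ∀ y y′ z → (b * y + y′) * z ≈ b * (y * z) + y′ * z
    distribute y y′ z = trans (distribʳ z (b * y) y′) (+-congʳ (*-assoc b y z))

  prod-linearʳ : ∀ o b (f g g′ : Ser) w → prod o f (λ v → b * g v + g′ v) w ≈ b * prod o f g w + prod o f g′ w
  prod-linearʳ o b f g g′ []       = sym (trans (+-congʳ (zeroʳ b)) (+-identityˡ 0#))
  prod-linearʳ o b f g g′ (a ∷ as) =
    trans (sumSplits-cong a as (λ U V → trans (sel-cong o _ _ (distribute (f (toWord U)) (g (toWord V)) (g′ (toWord V))))
                                              (sel-linear o _ _ b _ _)))
          (sumSplits-linear a as b _ _)
    where
    distribute : ∀ y z z′ → y * (b * z + z′) ≈ b * (y * z) + y * z′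
    distribute y z z′ = trans (distribˡ y (b * z) z′)
                              (+-congʳ (trans (sym (*-assoc y b z)) (trans (*-congʳ (*-comm y b)) (*-assoc b y z))))

  prod-zeroˡ : ∀ o (g : Ser) w → prod o (λ _ → 0#) g w ≈ 0#
  prod-zeroˡ o g []       = refl
  prod-zeroˡ o g (a ∷ as) = sumOver-zero (splits a as) (λ { (U , V) → trans (sel-cong o _ _ (zeroˡ _)) (sel-0# o _ _) })

  prod-zeroʳ : ∀ o (f : Ser) w → prod o f (λ _ → 0#) w ≈ 0#
  prod-zeroʳ o f []       = refl
  prod-zeroʳ o f (a ∷ as) = sumOver-zero (splits a as) (λ { (U , V) → trans (sel-cong o _ _ (zeroʳ _)) (sel-0# o _ _) })

module Evaluation {c ℓ : Level} (K : Field c ℓ) where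
  open Field K
  open Series K
  open FreeTri K
  open Ideal K
  open Sums K
  open Products K
  open BracketingIdentities K
  open import Algebra.Properties.Ring ring using (-‿distribˡ-*; -‿+-comm; -0#≈0#)
  open import Algebra.Properties.Group +-group using (x∙y⁻¹≈ε⇒x≈y)
  open import Algebra.Properties.CommutativeSemigroup +-commutativeSemigroup using (x∙yz≈y∙xz)
  open import Relation.Binary.Reasoning.Setoid setoid

  evalLC-++ : ∀ p q w → evalLC (p ++ q) w ≈ evalLC p w + evalLC q w
  evalLC-++ []            q w = sym (+-identityˡ _)
  evalLC-++ ((a , t) ∷ p) q w = trans (+-congˡ (evalLC-++ p q w)) (sym (+-assoc _ _ _))

  evalLC-neg : ∀ p w → evalLC (neg p) w ≈ - evalLC p w
  evalLC-neg []            w = sym -0#≈0#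
  evalLC-neg ((a , t) ∷ p) w =
    trans (+-cong (sym (-‿distribˡ-* a (evalT t w))) (evalLC-neg p w)) (-‿+-comm _ _)

  evalLC-scaleLC : ∀ a p w → evalLC (scaleLC a p) w ≈ a * evalLC p w
  evalLC-scaleLC a []            w = sym (zeroʳ a)
  evalLC-scaleLC a ((b , t) ∷ p) w =
    trans (+-cong (*-assoc a b _) (evalLC-scaleLC a p w)) (sym (distribˡ a _ _))

  evalLC-lOp : ∀ o p r w → evalLC (lOp o p r) w ≈ prod o (evalLC p) (evalT r) w
  evalLC-lOp o []            r w = sym (prod-zeroˡ o (evalT r) w)
  evalLC-lOp o ((b , s) ∷ p) r w = begin
    b * prod o (evalT s) (evalT r) w + evalLC (lOp o p r) w  ≈⟨ +-congˡ (evalLC-lOp o p r w) ⟩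
    b * prod o (evalT s) (evalT r) w + prod o (evalLC p) (evalT r) w ≈⟨ prod-linearˡ o b (evalT s) (evalLC p) (evalT r) w ⟨
    prod o (evalLC ((b , s) ∷ p)) (evalT r) w ∎

  evalLC-rOp : ∀ o l p w → evalLC (rOp o l p) w ≈ prod o (evalT l) (evalLC p) w
  evalLC-rOp o l []            w = sym (prod-zeroʳ o (evalT l) w)
  evalLC-rOp o l ((b , s) ∷ p) w = begin
    b * prod o (evalT l) (evalT s) w + evalLC (rOp o l p) w  ≈⟨ +-congˡ (evalLC-rOp o l p w) ⟩
    b * prod o (evalT l) (evalT s) w + prod o (evalT l) (evalLC p) w ≈⟨ prod-linearʳ o b (evalT l) (evalT s) (evalLC p) w ⟨
    prod o (evalT l) (evalLC ((b , s) ∷ p)) w ∎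

  Vanishes : LC → Set ℓ
  Vanishes p = ∀ w → evalLC p w ≈ 0#

  vanishes-plug : ∀ C p → Vanishes p → Vanishes (mapTrees (plug C) p)
  vanishes-plug hole p p≈0 w = trans (reflexive (≡.cong (λ q → evalLC q w) (map-id p))) (p≈0 w)
  vanishes-plug (inL o C r) p p≈0 w = begin
    evalLC (mapTrees (plug (inL o C r)) p) w             ≡⟨ ≡.cong (λ q → evalLC q w) (map-∘ p) ⟩
    evalLC (lOp o (mapTrees (plug C) p) r) w             ≈⟨ evalLC-lOp o (mapTrees (plug C) p) r w ⟩
    prod o (evalLC (mapTrees (plug C) p)) (evalT r) w    ≈⟨ prod-cong o (vanishes-plug C p p≈0) (λ _ → refl) w ⟩
    prod o (λ _ → 0#) (evalT r) w                        ≈⟨ prod-zeroˡ o (evalT r) w ⟩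
    0# ∎
  vanishes-plug (inR o l C) p p≈0 w = begin
    evalLC (mapTrees (plug (inR o l C)) p) w             ≡⟨ ≡.cong (λ q → evalLC q w) (map-∘ p) ⟩
    evalLC (rOp o l (mapTrees (plug C) p)) w             ≈⟨ evalLC-rOp o l (mapTrees (plug C) p) w ⟩
    prod o (evalT l) (evalLC (mapTrees (plug C) p)) w    ≈⟨ prod-cong o (λ _ → refl) (vanishes-plug C p p≈0) w ⟩
    prod o (evalT l) (λ _ → 0#) w                        ≈⟨ prod-zeroʳ o (evalT l) w ⟩
    0# ∎

  evalLC-leftBracketings : ∀ os s t u w →
    evalLC (leftBracketings os s t u) w ≈ sumOver os (λ p → leftBracket p (evalT s) (evalT t) (evalT u) w)
  evalLC-leftBracketings []       s t u w = refl
  evalLC-leftBracketings (p ∷ os) s t u w = +-cong (*-identityˡ _) (evalLC-leftBracketings os s t u w)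

  evalLC-rightBracketings : ∀ os s t u w →
    evalLC (rightBracketings os s t u) w ≈ sumOver os (λ p → rightBracket p (evalT s) (evalT t) (evalT u) w)
  evalLC-rightBracketings []       s t u w = refl
  evalLC-rightBracketings (p ∷ os) s t u w = +-cong (*-identityˡ _) (evalLC-rightBracketings os s t u w)

  relator-vanishes : ∀ R s t u → Vanishes (relator R s t u)
  relator-vanishes R s t u w = begin
    evalLC (relator R s t u) w
      ≡⟨ ≡.cong (λ q → evalLC q w) (relator-bracketings R s t u) ⟩
    evalLC (lhs ++ neg rhs) w                 ≈⟨ evalLC-++ lhs (neg rhs) w ⟩
    evalLC lhs w + evalLC (neg rhs) w         ≈⟨ +-cong (evalLC-leftBracketings (lhsOps R) s t u w) (evalLC-neg rhs w) ⟩
    sumOver (lhsOps R) left + - evalLC rhs w  ≈⟨ +-cong (bracketings-agree (lhsOps R) (rhsOps R) (relator-bracketingsAgree R) _ _ _ w)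
                                                        (-‿cong (evalLC-rightBracketings (rhsOps R) s t u w)) ⟩
    sumOver (rhsOps R) right + - sumOver (rhsOps R) right ≈⟨ -‿inverseʳ _ ⟩
    0# ∎
    where
    lhs   = leftBracketings (lhsOps R) s t u
    rhs   = rightBracketings (rhsOps R) s t u
    left  = λ p → leftBracket p (evalT s) (evalT t) (evalT u) w
    right = λ p → rightBracket p (evalT s) (evalT t) (evalT u) w

  gens-vanish : ∀ gs → Vanishes (gens gs)
  gens-vanish []                               w = refl
  gens-vanish (g@(a , C , R , s , t , u) ∷ gs) w = begin
    evalLC (genLC g ++ gens gs) w                                  ≈⟨ evalLC-++ (genLC g) (gens gs) w ⟩
    evalLC (genLC g) w + evalLC (gens gs) w                        ≈⟨ +-congˡ (gens-vanish gs w) ⟩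
    evalLC (genLC g) w + 0#                                        ≈⟨ +-identityʳ _ ⟩
    evalLC (genLC g) w                                             ≡⟨ ≡.cong (λ q → evalLC q w) (map-∘ (relator R s t u)) ⟩
    evalLC (scaleLC a (mapTrees (plug C) (relator R s t u))) w     ≈⟨ evalLC-scaleLC a (mapTrees (plug C) (relator R s t u)) w ⟩
    a * evalLC (mapTrees (plug C) (relator R s t u)) w
      ≈⟨ *-congˡ (vanishes-plug C (relator R s t u) (relator-vanishes R s t u) w) ⟩
    a * 0#                                                         ≈⟨ zeroʳ a ⟩
    0# ∎

  deleteTree : Tree → LC → LC
  deleteTree s []            = []
  deleteTree s ((a , t) ∷ p) with t ≟T s
  ... | yes _ = deleteTree s p
  ... | no  _ = (a , t) ∷ deleteTree s p

  length-deleteTree : ∀ s p → length (deleteTree s p) ≤ length p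
  length-deleteTree s []            = z≤n
  length-deleteTree s ((a , t) ∷ p) with t ≟T s
  ... | yes _ = m≤n⇒m≤1+n (length-deleteTree s p)
  ... | no  _ = s≤s (length-deleteTree s p)

  coeff-deleteTree-≡ : ∀ s p → coeff (deleteTree s p) s ≈ 0#
  coeff-deleteTree-≡ s []            = refl
  coeff-deleteTree-≡ s ((a , t) ∷ p) with t ≟T s
  ... | yes _ = coeff-deleteTree-≡ s p
  ... | no t≢s with t ≟T s
  ...   | yes t≡s = ⊥-elim (t≢s t≡s)
  ...   | no  _   = coeff-deleteTree-≡ s p

  coeff-deleteTree-≢ : ∀ s p t → s ≢ t → coeff (deleteTree s p) t ≈ coeff p t
  coeff-deleteTree-≢ s []             t s≢t = refl
  coeff-deleteTree-≢ s ((a , u) ∷ p) t s≢t with u ≟T s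
  ... | yes ≡.refl with u ≟T t
  ...   | yes u≡t = ⊥-elim (s≢t u≡t)
  ...   | no  _   = coeff-deleteTree-≢ s p t s≢t
  coeff-deleteTree-≢ s ((a , u) ∷ p) t s≢t | no _ with u ≟T t
  ...   | yes _ = +-congˡ (coeff-deleteTree-≢ s p t s≢t)
  ...   | no  _ = coeff-deleteTree-≢ s p t s≢t

  evalLC-deleteTree : ∀ s p w → evalLC p w ≈ coeff p s * evalT s w + evalLC (deleteTree s p) w
  evalLC-deleteTree s []            w = sym (trans (+-congʳ (zeroˡ _)) (+-identityˡ 0#))
  evalLC-deleteTree s ((a , t) ∷ p) w with t ≟T s
  ... | yes ≡.refl = begin
    a * evalT t w + evalLC p w                                     ≈⟨ +-congˡ (evalLC-deleteTree t p w) ⟩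
    a * evalT t w + (coeff p t * evalT t w + evalLC (deleteTree t p) w) ≈⟨ +-assoc _ _ _ ⟨
    (a * evalT t w + coeff p t * evalT t w) + evalLC (deleteTree t p) w ≈⟨ +-congʳ (distribʳ (evalT t w) a _) ⟨
    (a + coeff p t) * evalT t w + evalLC (deleteTree t p) w        ∎
  ... | no _ = begin
    a * evalT t w + evalLC p w                                     ≈⟨ +-congˡ (evalLC-deleteTree s p w) ⟩
    a * evalT t w + (coeff p s * evalT s w + evalLC (deleteTree s p) w) ≈⟨ x∙yz≈y∙xz _ _ _ ⟩
    coeff p s * evalT s w + (a * evalT t w + evalLC (deleteTree s p) w) ∎

  vanishes-of-coeff : ∀ p → (∀ t → coeff p t ≈ 0#) → Vanishes p
  vanishes-of-coeff p coeff≈0 = bounded (length p) p ≤-refl coeff≈0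
    where
    bounded : ∀ n p → length p ≤ n → (∀ t → coeff p t ≈ 0#) → Vanishes p
    bounded _       []            _           _       w = refl
    bounded (suc n) ((a , s) ∷ p) (s≤s len≤n) coeff≈0 w = begin
      evalLC ((a , s) ∷ p) w
        ≈⟨ evalLC-deleteTree s ((a , s) ∷ p) w ⟩
      coeff ((a , s) ∷ p) s * evalT s w + evalLC (deleteTree s ((a , s) ∷ p)) w
        ≈⟨ +-cong (trans (*-congʳ (coeff≈0 s)) (zeroˡ _))
                  (bounded n (deleteTree s ((a , s) ∷ p)) (≤-trans shorter len≤n) deleted≈0 w) ⟩
      0# + 0#
        ≈⟨ +-identityˡ 0# ⟩
      0# ∎
      where
      shorter : length (deleteTree s ((a , s) ∷ p)) ≤ length p
      shorter with s ≟T s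
      ... | yes _   = length-deleteTree s p
      ... | no  s≢s = ⊥-elim (s≢s ≡.refl)
      deleted≈0 : ∀ t → coeff (deleteTree s ((a , s) ∷ p)) t ≈ 0#
      deleted≈0 t with s ≟T t
      ... | yes ≡.refl = coeff-deleteTree-≡ s ((a , s) ∷ p)
      ... | no  s≢t    = trans (coeff-deleteTree-≢ s ((a , s) ∷ p) t s≢t) (coeff≈0 t)

  evalLC-cong : ∀ {p q} → (∀ t → coeff p t ≈ coeff q t) → ∀ w → evalLC p w ≈ evalLC q w
  evalLC-cong {p} {q} p≐q w = x∙y⁻¹≈ε⇒x≈y _ _ (begin
    evalLC p w + - evalLC q w          ≈⟨ +-congˡ (evalLC-neg q w) ⟨
    evalLC p w + evalLC (neg q) w      ≈⟨ evalLC-++ p (neg q) w ⟨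
    evalLC (p ++ neg q) w              ≈⟨ vanishes-of-coeff (p ++ neg q) difference≈0 w ⟩
    0#                                 ∎)
    where
    difference≈0 : ∀ t → coeff (p ++ neg q) t ≈ 0#
    difference≈0 t = begin
      coeff (p ++ neg q) t               ≈⟨ coeff-++ p (neg q) t ⟩
      coeff p t + coeff (neg q) t        ≈⟨ +-cong (p≐q t) (coeff-neg q t) ⟩
      coeff q t + - coeff q t            ≈⟨ -‿inverseʳ _ ⟩
      0#                                 ∎

  evalLC-respects-≈ᴵ : ∀ {p q} → p ≈ᴵ q → ∀ w → evalLC p w ≈ evalLC q w
  evalLC-respects-≈ᴵ {p} {q} (mod gs p≈q+gs) w = begin
    evalLC p w
      ≈⟨ evalLC-cong {p} {q ++ gens gs} (λ t → trans (p≈q+gs t) (sym (coeff-++ q (gens gs) t))) w ⟩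
    evalLC (q ++ gens gs) w            ≈⟨ evalLC-++ q (gens gs) w ⟩
    evalLC q w + evalLC (gens gs) w    ≈⟨ +-congˡ (gens-vanish gs w) ⟩
    evalLC q w + 0#                    ≈⟨ +-identityʳ _ ⟩
    evalLC q w                         ∎

module NormalFormEvaluation {c ℓ : Level} (K : Field c ℓ) where
  open Field K
  open Series K
  open FreeTri K
  open Sums K
  open import Relation.Binary.Reasoning.Setoid setoid

  indicator : Bool → Carrier
  indicator b = onlyIf b 1#

  indicator-false : ∀ {b} → b ≡ false → indicator b ≈ 0#
  indicator-false ≡.refl = refl

  atSplit-extend : ∀ h P ms → atSplit P (Maybe.map (λ { ((u , us) , V) → ((h , u ∷ us) , V) }) ms)
                              ≡ atSplit (λ U V → P (h , toWord U) V) ms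
  atSplit-extend h P nothing  = ≡.refl
  atSplit-extend h P (just _) = ≡.refl

  sumSplits-first : ∀ m h t (P : Word⁺ → Word⁺ → Bool) →
    (∀ U V → proj₁ U ≡ h → maxW h t ≡ max⁺ U ⊔ max⁺ V → P U V ≡ true →
             proj₁ V ≡ m × All (_≢ m) (proj₂ U)) →
    sumSplits h t (λ U V → indicator (P U V)) ≈ indicator (atSplit P (splitBefore m h t))
  sumSplits-first m h []       P first = refl
  sumSplits-first m h (y ∷ ys) P first with y ≟ m
  ... | yes y≡m = begin
    sumSplits h (y ∷ ys) (λ U V → indicator (P U V))
      ≡⟨ sumSplits-∷ h y ys _ ⟩
    indicator (P (h , []) (y , ys)) + sumSplits y ys (λ U V → indicator (P (h , toWord U) V))
      ≈⟨ +-congˡ (trans (sumSplits-cong-split y ys later) (sumOver-zero (splits y ys) (λ _ → refl))) ⟩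
    indicator (P (h , []) (y , ys)) + 0#
      ≈⟨ +-identityʳ _ ⟩
    indicator (P (h , []) (y , ys)) ∎
    where
    later : ∀ U V → proj₁ U ≡ y → maxW y ys ≡ max⁺ U ⊔ max⁺ V → indicator (P (h , toWord U) V) ≈ 0#
    later U V U≡y max≡ with P (h , toWord U) V in match
    ... | false = refl
    ... | true with first (h , toWord U) V ≡.refl
                          (≡.trans (≡.cong (h ⊔_) max≡) (≡.sym (⊔-assoc h (max⁺ U) (max⁺ V)))) match
    ...   | _ , (U≢m ∷ _) = ⊥-elim (U≢m (≡.trans U≡y y≡m))
  ... | no y≢m = begin
    sumSplits h (y ∷ ys) (λ U V → indicator (P U V))
      ≡⟨ sumSplits-∷ h y ys _ ⟩
    indicator (P (h , []) (y , ys)) + sumSplits y ys (λ U V → indicator (P (h , toWord U) V))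
      ≈⟨ +-cong here (sumSplits-first m y ys (λ U V → P (h , toWord U) V) first′) ⟩
    0# + indicator (atSplit (λ U V → P (h , toWord U) V) (splitBefore m y ys))
      ≈⟨ +-identityˡ _ ⟩
    indicator (atSplit (λ U V → P (h , toWord U) V) (splitBefore m y ys))
      ≡⟨ ≡.cong indicator (atSplit-extend h P (splitBefore m y ys)) ⟨
    indicator (atSplit P (Maybe.map (λ { ((u , us) , V) → ((h , u ∷ us) , V) }) (splitBefore m y ys))) ∎
    where
    here : indicator (P (h , []) (y , ys)) ≈ 0#
    here with P (h , []) (y , ys) in match
    ... | false = refl
    ... | true  = ⊥-elim (y≢m (proj₁ (first (h , []) (y , ys) ≡.refl ≡.refl match)))
    first′ : ∀ U V → proj₁ U ≡ y → maxW y ys ≡ max⁺ U ⊔ max⁺ V → P (h , toWord U) V ≡ true →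
             proj₁ V ≡ m × All (_≢ m) (proj₂ U)
    first′ U V ≡.refl max≡ match
      with V≡m , (_ ∷ us≢m) ← first (h , toWord U) V ≡.refl
                                    (≡.trans (≡.cong (h ⊔_) max≡) (≡.sym (⊔-assoc h (max⁺ U) (max⁺ V)))) match =
      V≡m , us≢m

  onlyIf-indicator-* : ∀ b b₁ b₂ → onlyIf b (indicator b₁ * indicator b₂) ≈ indicator (b ∧ (b₁ ∧ b₂))
  onlyIf-indicator-* false b₁    b₂    = refl
  onlyIf-indicator-* true  true  true  = *-identityˡ 1#
  onlyIf-indicator-* true  true  false = zeroʳ 1#
  onlyIf-indicator-* true  false b₂    = zeroˡ _

  prod-indicators : ∀ o {f g : Ser} (p q : Word → Bool) →
                    (∀ w → f w ≈ indicator (p w)) → (∀ w → g w ≈ indicator (q w)) →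
                    ∀ h t → prod o f g (h ∷ t) ≈ sumSplits h t (λ U V → indicator (productMatch o p q U V))
  prod-indicators o {f} {g} p q f≈p g≈q h t = sumSplits-cong h t λ U V → begin
    sel o (max⁺ U) (max⁺ V) (f (toWord U) * g (toWord V))
      ≡⟨ sel-onlyIf o (max⁺ U) (max⁺ V) _ ⟩
    onlyIf (holds o (compare (max⁺ U) (max⁺ V))) (f (toWord U) * g (toWord V))
      ≈⟨ onlyIf-cong (holds o (compare (max⁺ U) (max⁺ V))) (*-cong (f≈p (toWord U)) (g≈q (toWord V))) ⟩
    onlyIf (holds o (compare (max⁺ U) (max⁺ V))) (indicator (p (toWord U)) * indicator (q (toWord V)))
      ≈⟨ onlyIf-indicator-* (holds o (compare (max⁺ U) (max⁺ V))) (p (toWord U)) (q (toWord V)) ⟩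
    indicator (productMatch o p q U V) ∎

  M₁-indicator : ∀ w → M₁ w ≈ indicator (matchesᵃ gen w)
  M₁-indicator []          = refl
  M₁-indicator (_ ∷ [])    = refl
  M₁-indicator (_ ∷ _ ∷ _) = refl

  mutual
    evalT-atom : ∀ a w → evalT ⟦ a ⟧ᵃ w ≈ indicator (matchesᵃ a w)
    evalT-atom gen      w            = M₁-indicator w
    evalT-atom (gen◁ e) []           = refl
    evalT-atom (gen◁ e) (h ∷ [])     = refl
    evalT-atom (gen◁ e) (h ∷ y ∷ ys) = begin
      prod ◁ M₁ (evalT ⟦ e ⟧) (h ∷ y ∷ ys)
        ≈⟨ prod-indicators ◁ (matchesᵃ gen) (matches e) M₁-indicator (evalT-nf e) h (y ∷ ys) ⟩
      sumSplits h (y ∷ ys) (λ U V → indicator (productMatch ◁ (matchesᵃ gen) (matches e) U V))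
        ≡⟨ sumSplits-∷ h y ys _ ⟩
      indicator (matchesᵃ (gen◁ e) (h ∷ y ∷ ys)) +
      sumSplits y ys (λ U V → indicator (productMatch ◁ (matchesᵃ gen) (matches e) (h , toWord U) V))
        ≈⟨ +-congˡ (sumOver-zero (splits y ys) λ { (U , V) →
                      indicator-false (∧-zeroʳ (holds ◁ (compare (max⁺ (h , toWord U)) (max⁺ V)))) }) ⟩
      indicator (matchesᵃ (gen◁ e) (h ∷ y ∷ ys)) + 0#
        ≈⟨ +-identityʳ _ ⟩
      indicator (matchesᵃ (gen◁ e) (h ∷ y ∷ ys)) ∎

    evalT-chain : ∀ k w → evalT ⟦ k ⟧ᶜ w ≈ indicator (matchesᶜ k w)
    evalT-chain (atom a) w       = evalT-atom a w
    evalT-chain (a ∘ₙ k) []      = refl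
    evalT-chain (a ∘ₙ k) (h ∷ t) =
      trans (prod-indicators ∘ (matchesᵃ a) (matchesᶜ k) (evalT-atom a) (evalT-chain k) h t)
            (sumSplits-first h h t (productMatch ∘ (matchesᵃ a) (matchesᶜ k)) first)
      where
      first : ∀ U V → proj₁ U ≡ h → maxW h t ≡ max⁺ U ⊔ max⁺ V →
              productMatch ∘ (matchesᵃ a) (matchesᶜ k) U V ≡ true →
              proj₁ V ≡ h × All (_≢ h) (proj₂ U)
      first (u , us) (v , vs) ≡.refl _ match
        with U≡V , matchU , matchV ← productMatch-true ∘ (matchesᵃ a) (matchesᶜ k) (u , us) (v , vs) match
        with us≢u , maxU≡u ← atom-shape a u us matchU =
        ≡.trans (≡.sym (chain-max k v vs matchV)) (≡.trans (≡.sym (holds-∘ _ _ U≡V)) maxU≡u) , us≢u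

    evalT-nf : ∀ e w → evalT ⟦ e ⟧ w ≈ indicator (matches e w)
    evalT-nf (chain k) w       = evalT-chain k w
    evalT-nf (e ▷ₙ k) []       = refl
    evalT-nf (e ▷ₙ k) (h ∷ t)  =
      trans (prod-indicators ▷ (matches e) (matchesᶜ k) (evalT-nf e) (evalT-chain k) h t)
            (sumSplits-first (maxW h t) h t (productMatch ▷ (matches e) (matchesᶜ k)) first)
      where
      first : ∀ U V → proj₁ U ≡ h → maxW h t ≡ max⁺ U ⊔ max⁺ V →
              productMatch ▷ (matches e) (matchesᶜ k) U V ≡ true →
              proj₁ V ≡ maxW h t × All (_≢ maxW h t) (proj₂ U)
      first (u , us) (v , vs) _ max≡ match
        with U▷V , _ , matchV ← productMatch-true ▷ (matches e) (matchesᶜ k) (u , us) (v , vs) match =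
        ≡.trans (≡.sym (chain-max k v vs matchV)) (≡.sym max≡V) ,
        all-≢-of-< (All.tail (maxW-upperBound u us)) (≡.subst (maxW u us <_) (≡.sym max≡V) U<V)
        where
        U<V : maxW u us < maxW v vs
        U<V = holds-▷ _ _ U▷V
        max≡V : maxW h t ≡ maxW v vs
        max≡V = ≡.trans max≡ (m≤n⇒m⊔n≡n (<⇒≤ U<V))

module Independence {c ℓ : Level} (K : Field c ℓ) where
  open Field K
  open Series K
  open FreeTri K
  open Sums K using (onlyIf)
  open Spanning K using (NfLC; toLC)
  open Evaluation K using (Vanishes)
  open NormalFormEvaluation K
  open import Relation.Binary.Reasoning.Setoid setoid

  evalLC-witness : ∀ (P : NfLC) f → evalLC (toLC P) (toWord (witness f)) ≈ coeff (toLC P) ⟦ f ⟧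
  evalLC-witness []            f = refl
  evalLC-witness ((a , e) ∷ P) f with ⟦ e ⟧ ≟T ⟦ f ⟧
  ... | yes ⟦e⟧≡⟦f⟧ = +-cong (begin
    a * evalT ⟦ e ⟧ (toWord (witness f))         ≡⟨ ≡.cong (λ s → a * evalT s (toWord (witness f))) ⟦e⟧≡⟦f⟧ ⟩
    a * evalT ⟦ f ⟧ (toWord (witness f))         ≈⟨ *-congˡ (evalT-nf f (toWord (witness f))) ⟩
    a * indicator (matches f (toWord (witness f))) ≡⟨ ≡.cong (λ b → a * indicator b) (witness-matches f) ⟩
    a * 1#                                       ≈⟨ *-identityʳ a ⟩
    a                                            ∎) (evalLC-witness P f)
  ... | no ⟦e⟧≢⟦f⟧ = trans (+-cong (trans (*-congˡ (evalT-nf e (toWord (witness f)))) unmatched) (evalLC-witness P f))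
                           (+-identityˡ _)
    where
    unmatched : a * indicator (matches e (toWord (witness f))) ≈ 0#
    unmatched with matches e (toWord (witness f)) in match
    ... | true  = ⊥-elim (⟦e⟧≢⟦f⟧ (≡.cong ⟦_⟧ (matches-witness⇒≡ e f match)))
    ... | false = zeroʳ a

  toLC-support : ∀ (P : NfLC) t → coeff (toLC P) t ≈ 0# ⊎ ∃ λ f → ⟦ f ⟧ ≡ t
  toLC-support []            t = inj₁ refl
  toLC-support ((a , e) ∷ P) t with ⟦ e ⟧ ≟T t
  ... | yes ⟦e⟧≡t = inj₂ (e , ⟦e⟧≡t)
  ... | no  _     = toLC-support P t

  normalForms-independent : ∀ (P : NfLC) → Vanishes (toLC P) → ∀ t → coeff (toLC P) t ≈ 0#
  normalForms-independent P P≈0 t with toLC-support P t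
  ... | inj₁ coeff≈0        = coeff≈0
  ... | inj₂ (f , ≡.refl)   = trans (sym (evalLC-witness P f)) (P≈0 (toWord (witness f)))

mainTheorem19 : ∀ {c ℓ : Level} (K : Field c ℓ) → CharZero K →
    (p : FreeTri.LC K) →
    (∀ (w : List _) → Field._≈_ K (FreeTri.evalLC K p w) (Field.0# K)) →
    FreeTri.InIdeal K p
mainTheorem19 K _ p p-vanishes = generators , λ t → begin
    coeff p t                                     ≈⟨ coeff-≈ t ⟩
    coeff (toLC P) t + coeff (gens generators) t  ≈⟨ +-congʳ (normalForms-independent P P-vanishes t) ⟩
    0# + coeff (gens generators) t                ≈⟨ +-identityˡ _ ⟩
    coeff (gens generators) t                     ∎
  where
  open Field K
  open FreeTri K
  open Ideal K
  open Spanning K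
  open Evaluation K
  open Independence K
  open import Relation.Binary.Reasoning.Setoid setoid
  P = normaliseLC p
  p≈ᴵP = normaliseLC-correct p
  open _≈ᴵ_ p≈ᴵP
  P-vanishes : Vanishes (toLC P)
  P-vanishes w = trans (sym (evalLC-respects-≈ᴵ p≈ᴵP w)) (p-vanishes w)
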